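{- Let $P \in [0,1]^{n\times n}$ be a stochastic matrix with rational entries (not necessarily irreducible), let $(X_0,X_1,\dots)$ be a Markov chain on $\{1,\dots,n\}$ with transition matrix $P$, and let $r \in \mathbb{Z}^n$. Define the gain vector $\chi \in \mathbb{R}^n$ by $\chi_i \coloneqq \lim_{N\to\infty} \frac{1}{N}\mathbb{E}(r_{X_0}+\dots+r_{X_N} \mid X_0 = i)$ (this limit exists). Suppose that $\chi = \eta(1,1,\dots,1)$ for some $\eta \in \mathbb{R}$. Then $\eta$ is a rational number with denominator not greater than $\min\{nD, nM^{n-1}\}$.
   Context: For each $i$, $M_i$ is the lowest common denominator of the entries of the $i$-th row of $P$; $M$ is the lowest common denominator of all entries of $P$; $D \coloneqq M_1\cdots M_n$. -}

module Defs where

open import Data.Nat as ℕ using (ℕ; zero; suc)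
open import Data.Nat.LCM using (lcm)
open import Data.Integer as ℤ using (ℤ)
open import Data.Fin using (Fin; zero; suc)
open import Data.Product using (∃; ∃-syntax; _×_)
open import Relation.Binary.PropositionalEquality using (_≡_)
open import Data.Rational using (ℚ; 0ℚ; 1ℚ; _+_; _*_; _-_; ∣_∣; _<_; _≤_; _/_; ↧ₙ_)

Matrix : ℕ → Set
Matrix n = Fin n → Fin n → ℚ

Σ : ∀ {n} → (Fin n → ℚ) → ℚ
Σ {zero}  f = 0ℚ
Σ {suc n} f = f zero + Σ (λ i → f (suc i))

IsStochastic : ∀ {n} → Matrix n → Set
IsStochastic {n} P = (∀ i j → 0ℚ ≤ P i j) × (∀ i → Σ (P i) ≡ 1ℚ)

mulVec : ∀ {n} → Matrix n → (Fin n → ℚ) → (Fin n → ℚ)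
mulVec P v i = Σ (λ j → P i j * v j)

powVec : ∀ {n} → ℕ → Matrix n → (Fin n → ℚ) → (Fin n → ℚ)
powVec zero    P v = v
powVec (suc k) P v = mulVec P (powVec k P v)

toℚ : ∀ {n} → (Fin n → ℤ) → (Fin n → ℚ)
toℚ r i = r i / 1

-- E(r_{X_0} + ... + r_{X_N} | X_0 = i) = Σ_{k=0}^{N} (P^k r)_i
expectedReward : ∀ {n} → Matrix n → (Fin n → ℤ) → ℕ → Fin n → ℚ
expectedReward P r zero    i = toℚ r i
expectedReward P r (suc N) i = expectedReward P r N i + powVec (suc N) P (toℚ r) i

-- Cesàro average (1/N) E(r_{X_0}+...+r_{X_N} | X_0 = i), for N = suc m ≥ 1
avgReward : ∀ {n} → Matrix n → (Fin n → ℤ) → ℕ → Fin n → ℚ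
avgReward P r m i = (ℤ.+ 1 / suc m) * expectedReward P r (suc m) i

ConvergesTo : (ℕ → ℚ) → ℚ → Set
ConvergesTo a q = ∀ ε → 0ℚ < ε → ∃[ N₀ ] (∀ N → N₀ ℕ.≤ N → ∣ a N - q ∣ < ε)

lcmFin : ∀ {n} → (Fin n → ℕ) → ℕ
lcmFin {zero}  f = 1
lcmFin {suc n} f = lcm (f zero) (lcmFin (λ i → f (suc i)))

prodFin : ∀ {n} → (Fin n → ℕ) → ℕ
prodFin {zero}  f = 1
prodFin {suc n} f = f zero ℕ.* prodFin (λ i → f (suc i))

-- M_i : lowest common denominator of row i of P
rowDen : ∀ {n} → Matrix n → Fin n → ℕ
rowDen P i = lcmFin (λ j → ↧ₙ P i j)

-- M : lowest common denominator of all entries of P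
allDen : ∀ {n} → Matrix n → ℕ
allDen P = lcmFin (rowDen P)

-- D = M_1 ⋯ M_n
prodRowDen : ∀ {n} → Matrix n → ℕ
prodRowDen P = prodFin (rowDen P)

-- Markov chain tree theorem: the weights Wᵢ = Σ, over the spanning arborescences rooted at i, of the
-- product of their edge probabilities form a nonnegative left-invariant vector of P with Wᵢ ≤ 1. Row i
-- never enters Wᵢ, so scaling by D, or by M for every row but i (that is, by M^(n−1)), makes Wᵢ an
-- integer. If P is reducible, first pass to a closed set in which some state c is reachable from
-- everywhere and send every other state straight to c: then a tree of paths to c has positive weight,
-- and all weights vanish outside the closed set, so they are still invariant for P.
-- Pairing the Cesàro averages aᵢ(N) with W gives Σᵢ Wᵢ aᵢ(N) = (1 + 1/(N+1)) Σᵢ Wᵢ rᵢ, so their common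
-- limit is η = Σᵢ Wᵢ rᵢ / Σᵢ Wᵢ. For Λ = D or M^(n−1), η · Λ Σᵢ Wᵢ = Λ Σᵢ Wᵢ rᵢ is an integer and
-- 0 < Λ Σᵢ Wᵢ ≤ nΛ, so the denominator of η is at most nΛ.

module Submission where

open import Defs

open import Algebra.Bundles using (Ring)
open import Data.Bool using (true; if_then_else_)
open import Data.Empty using (⊥; ⊥-elim)
open import Data.Fin as Fin using (Fin; zero; suc; toℕ)
import Data.Fin.Properties as Finₚ
open import Data.Fin.Subset as Subset using (Subset; _∈_; _∉_; _⊆_; _⊂_; ⁅_⁆; _∪_; _∩_; ∁; ⊤)
open import Data.Fin.Subset.Properties
  using (_∈?_; _⊆?_; ∈⊤; x∈⁅x⁆; x∈⁅y⁆⇒x≡y; ∣⁅x⁆∣≡1; ∣p∣≤n; p⊂q⇒∣p∣<∣q∣; p⊆p∪q; q⊆p∪q; x∈p∪q⁻; p∩q⊆p; x∈p∩q⁺; x∈p∩q⁻; x∈∁p⇒x∉p; x∉p⇒x∈∁p)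
open import Data.Integer as ℤ using (ℤ; +_; -[1+_])
import Data.Integer.Properties as ℤₚ
open import Data.Nat as ℕ using (ℕ; zero; suc; z≤n; s≤s; _∸_; _^_; _⊓_; _⊔_)
open import Data.Nat.Coprimality as Coprimality using (Coprime; coprime-divisor)
open import Data.Nat.Divisibility using (_∣_; divides; ∣-trans; ∣⇒≤)
open import Data.Nat.GCD using (gcd)
open import Data.Nat.GeneralisedArithmetic using (iterate)
open import Data.Nat.Induction using (<-rec)
open import Data.Nat.LCM using (lcm; m∣lcm[m,n]; n∣lcm[m,n]; gcd*lcm)
import Data.Nat.Properties as ℕₚ
open import Data.Product using (Σ-syntax; ∃-syntax; _×_; _,_; proj₁; proj₂)
open import Data.Rational as ℚ
  using (ℚ; mkℚ; 0ℚ; 1ℚ; ½; _+_; _*_; _-_; -_; 1/_; ∣_∣; _≤_; _<_; ↥_; ↧_; ↧ₙ_; _/_)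
import Data.Rational.Properties as ℚₚ
open import Data.Rational.Solver using (module +-*-Solver)
open import Data.Rational.Unnormalised as ℚᵘ using (mkℚᵘ)
import Data.Rational.Unnormalised.Properties as ℚᵘₚ
open import Data.Sum using (_⊎_; inj₁; inj₂)
open import Data.Vec using (Vec; []; _∷_; lookup; tabulate; _[_]≔_)
import Data.Vec.Properties as Vecₚ
open import Function using (_∘_; id)
open import Relation.Binary.Definitions using (tri<; tri≈; tri>)
open import Relation.Binary.PropositionalEquality
open import Relation.Nullary using (Dec; yes; no; ¬_; does)
open import Relation.Nullary.Decidable using (_×-dec_; _→-dec_; dec-true; dec-false)

open import Algebra.Properties.Semiring.Sum (Ring.semiring ℚₚ.+-*-ring)
  using (sum; sum-cong-≗; ∑-distrib-+; ∑-comm; *-distribˡ-sum; *-distribʳ-sum; sum-replicate-zero)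
open import Algebra.Properties.CommutativeMonoid.Sum ℚₚ.*-1-commutativeMonoid
  using () renaming (sum to prod; sum-cong-≗ to prod-cong; ∑-distrib-+ to prod-distrib-*;
                     sum-replicate-zero to prod-replicate-one)
open +-*-Solver using (solve; _:+_; _:*_; _:-_; :-_; _:=_; con)

Σ≡sum : ∀ {n} (f : Fin n → ℚ) → Σ f ≡ sum f
Σ≡sum {zero}  f = refl
Σ≡sum {suc n} f = cong (_+_ (f zero)) (Σ≡sum (λ i → f (suc i)))

𝟙 : ∀ {p} {P : Set p} → Dec P → ℚ
𝟙 (yes _) = 1ℚ
𝟙 (no _)  = 0ℚ

𝟙-yes : ∀ {p} {P : Set p} (d : Dec P) → P → 𝟙 d ≡ 1ℚ
𝟙-yes (yes _) _ = refl
𝟙-yes (no ¬p) p = ⊥-elim (¬p p)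

𝟙-no : ∀ {p} {P : Set p} (d : Dec P) → ¬ P → 𝟙 d ≡ 0ℚ
𝟙-no (yes p) ¬p = ⊥-elim (¬p p)
𝟙-no (no _)  _  = refl

𝟙-cong : ∀ {p q} {P : Set p} {Q : Set q} (d : Dec P) (e : Dec Q) → (P → Q) → (Q → P) → 𝟙 d ≡ 𝟙 e
𝟙-cong (yes _) (yes _) _ _ = refl
𝟙-cong (yes p) (no ¬q) f _ = ⊥-elim (¬q (f p))
𝟙-cong (no ¬p) (yes q) _ g = ⊥-elim (¬p (g q))
𝟙-cong (no _)  (no _)  _ _ = refl

𝟙-×-dec : ∀ {p q} {P : Set p} {Q : Set q} (d : Dec P) (e : Dec Q) → 𝟙 (d ×-dec e) ≡ 𝟙 d * 𝟙 e
𝟙-×-dec (yes _) (yes _) = refl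
𝟙-×-dec (yes _) (no _)  = refl
𝟙-×-dec (no _)  (yes _) = refl
𝟙-×-dec (no _)  (no _)  = refl

0≤1 : 0ℚ ≤ 1ℚ
0≤1 = ℚₚ.nonNegative⁻¹ 1ℚ

0<1 : 0ℚ < 1ℚ
0<1 = ℚₚ.positive⁻¹ 1ℚ

0≤𝟙 : ∀ {p} {P : Set p} (d : Dec P) → 0ℚ ≤ 𝟙 d
0≤𝟙 (yes _) = 0≤1
0≤𝟙 (no _)  = ℚₚ.≤-refl

𝟙≤1 : ∀ {p} {P : Set p} (d : Dec P) → 𝟙 d ≤ 1ℚ
𝟙≤1 (yes _) = ℚₚ.≤-refl
𝟙≤1 (no _)  = 0≤1

*-nonNeg : ∀ {p q} → 0ℚ ≤ p → 0ℚ ≤ q → 0ℚ ≤ p * q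
*-nonNeg {p} {q} 0≤p 0≤q =
  ℚₚ.nonNegative⁻¹ _ {{ℚₚ.nonNeg*nonNeg⇒nonNeg p {{ℚ.nonNegative 0≤p}} q {{ℚ.nonNegative 0≤q}}}}

*-pos : ∀ {p q} → 0ℚ < p → 0ℚ < q → 0ℚ < p * q
*-pos {p} {q} 0<p 0<q = ℚₚ.positive⁻¹ _ {{ℚₚ.pos*pos⇒pos p {{ℚ.positive 0<p}} q {{ℚ.positive 0<q}}}}

sum-δ : ∀ {n} (k : Fin n) (f : Fin n → ℚ) → sum (λ i → 𝟙 (i Finₚ.≟ k) * f i) ≡ f k
sum-δ {suc n} zero f = begin
  1ℚ * f zero + sum (λ i → 0ℚ * f (suc i)) ≡⟨ cong (_+_ (1ℚ * f zero)) (sum-cong-≗ (λ i → ℚₚ.*-zeroˡ (f (suc i)))) ⟩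
  1ℚ * f zero + sum {n} (λ _ → 0ℚ)        ≡⟨ cong (_+_ (1ℚ * f zero)) (sum-replicate-zero n) ⟩
  1ℚ * f zero + 0ℚ                         ≡⟨ ℚₚ.+-identityʳ _ ⟩
  1ℚ * f zero                              ≡⟨ ℚₚ.*-identityˡ _ ⟩
  f zero                                   ∎
  where open ≡-Reasoning
sum-δ {suc n} (suc k) f = begin
  0ℚ * f zero + sum (λ i → 𝟙 (suc i Finₚ.≟ suc k) * f (suc i))
    ≡⟨ cong₂ _+_ (ℚₚ.*-zeroˡ (f zero)) (sum-cong-≗ (λ i → cong (_* f (suc i)) (𝟙-cong (suc i Finₚ.≟ suc k) (i Finₚ.≟ k) Finₚ.suc-injective (cong suc)))) ⟩
  0ℚ + sum (λ i → 𝟙 (i Finₚ.≟ k) * f (suc i))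
    ≡⟨ ℚₚ.+-identityˡ _ ⟩
  sum (λ i → 𝟙 (i Finₚ.≟ k) * f (suc i))
    ≡⟨ sum-δ k (λ i → f (suc i)) ⟩
  f (suc k) ∎
  where open ≡-Reasoning

sum-𝟙-unique : ∀ {n p} {P : Fin n → Set p} (P? : ∀ i → Dec (P i)) (i₀ : Fin n) →
               P i₀ → (∀ i → P i → i ≡ i₀) → sum (λ i → 𝟙 (P? i)) ≡ 1ℚ
sum-𝟙-unique P? i₀ p unique = begin
  sum (λ i → 𝟙 (P? i))                    ≡⟨ sum-cong-≗ (λ i → 𝟙-cong (P? i) (i Finₚ.≟ i₀) (unique i) (λ { refl → p })) ⟩
  sum (λ i → 𝟙 (i Finₚ.≟ i₀))             ≡⟨ sum-cong-≗ (λ i → sym (ℚₚ.*-identityʳ (𝟙 (i Finₚ.≟ i₀)))) ⟩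
  sum (λ i → 𝟙 (i Finₚ.≟ i₀) * 1ℚ)        ≡⟨ sum-δ i₀ (λ _ → 1ℚ) ⟩
  1ℚ                                        ∎
  where open ≡-Reasoning

sum-nonNeg : ∀ {n} (f : Fin n → ℚ) → (∀ i → 0ℚ ≤ f i) → 0ℚ ≤ sum f
sum-nonNeg {zero}  f _   = ℚₚ.≤-refl
sum-nonNeg {suc n} f f≥0 = ℚₚ.+-mono-≤ (f≥0 zero) (sum-nonNeg (λ i → f (suc i)) (λ i → f≥0 (suc i)))

sum-mono-≤ : ∀ {n} (f g : Fin n → ℚ) → (∀ i → f i ≤ g i) → sum f ≤ sum g
sum-mono-≤ {zero}  f g _   = ℚₚ.≤-refl
sum-mono-≤ {suc n} f g f≤g = ℚₚ.+-mono-≤ (f≤g zero) (sum-mono-≤ (λ i → f (suc i)) (λ i → g (suc i)) (λ i → f≤g (suc i)))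

term≤sum : ∀ {n} (f : Fin n → ℚ) → (∀ i → 0ℚ ≤ f i) → ∀ k → f k ≤ sum f
term≤sum {suc n} f f≥0 zero =
  subst (_≤ sum f) (ℚₚ.+-identityʳ (f zero)) (ℚₚ.+-monoʳ-≤ (f zero) (sum-nonNeg (λ i → f (suc i)) (λ i → f≥0 (suc i))))
term≤sum {suc n} f f≥0 (suc k) =
  subst (_≤ sum f) (ℚₚ.+-identityˡ (f (suc k))) (ℚₚ.+-mono-≤ (f≥0 zero) (term≤sum (λ i → f (suc i)) (λ i → f≥0 (suc i)) k))

prod-nonNeg : ∀ {n} (f : Fin n → ℚ) → (∀ i → 0ℚ ≤ f i) → 0ℚ ≤ prod f
prod-nonNeg {zero}  f _   = 0≤1
prod-nonNeg {suc n} f f≥0 = *-nonNeg (f≥0 zero) (prod-nonNeg (λ i → f (suc i)) (λ i → f≥0 (suc i)))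

prod-pos : ∀ {n} (f : Fin n → ℚ) → (∀ i → 0ℚ < f i) → 0ℚ < prod f
prod-pos {zero}  f _   = 0<1
prod-pos {suc n} f f>0 = *-pos (f>0 zero) (prod-pos (λ i → f (suc i)) (λ i → f>0 (suc i)))

prod-zero : ∀ {n} (f : Fin n → ℚ) k → f k ≡ 0ℚ → prod f ≡ 0ℚ
prod-zero {suc n} f zero    fk≡0 = trans (cong (_* prod (λ i → f (suc i))) fk≡0) (ℚₚ.*-zeroˡ (prod (λ i → f (suc i))))
prod-zero {suc n} f (suc k) fk≡0 = trans (cong (f zero *_) (prod-zero (λ i → f (suc i)) k fk≡0)) (ℚₚ.*-zeroʳ (f zero))

prod-exchange : ∀ {n} (f g : Fin n → ℚ) i → (∀ j → j ≢ i → f j ≡ g j) → prod f * g i ≡ prod g * f i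
prod-exchange {suc n} f g zero f≗g = begin
  f zero * prod (λ j → f (suc j)) * g zero ≡⟨ cong (λ x → f zero * x * g zero) (prod-cong (λ j → f≗g (suc j) λ ())) ⟩
  f zero * prod (λ j → g (suc j)) * g zero ≡⟨ solve 3 (λ a b c → a :* b :* c := c :* b :* a) refl (f zero) _ (g zero) ⟩
  g zero * prod (λ j → g (suc j)) * f zero ∎
  where open ≡-Reasoning
prod-exchange {suc n} f g (suc i) f≗g = begin
  f zero * prod (λ j → f (suc j)) * g (suc i)   ≡⟨ ℚₚ.*-assoc (f zero) _ _ ⟩
  f zero * (prod (λ j → f (suc j)) * g (suc i)) ≡⟨ cong₂ _*_ (f≗g zero λ ())
                                                      (prod-exchange (λ j → f (suc j)) (λ j → g (suc j)) i
                                                        (λ j j≢i → f≗g (suc j) (j≢i ∘ Finₚ.suc-injective))) ⟩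
  g zero * (prod (λ j → g (suc j)) * f (suc i)) ≡⟨ ℚₚ.*-assoc (g zero) _ _ ⟨
  g zero * prod (λ j → g (suc j)) * f (suc i)   ∎
  where open ≡-Reasoning

sumAll : ∀ {n} m → (Vec (Fin n) m → ℚ) → ℚ
sumAll zero    F = F []
sumAll (suc m) F = sum (λ x → sumAll m (λ v → F (x ∷ v)))

module _ {n : ℕ} where

  sumAll-cong : ∀ m {F G : Vec (Fin n) m → ℚ} → (∀ v → F v ≡ G v) → sumAll m F ≡ sumAll m G
  sumAll-cong zero    F≗G = F≗G []
  sumAll-cong (suc m) F≗G = sum-cong-≗ (λ x → sumAll-cong m (λ v → F≗G (x ∷ v)))

  sumAll-zero : ∀ m → sumAll {n} m (λ _ → 0ℚ) ≡ 0ℚ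
  sumAll-zero zero    = refl
  sumAll-zero (suc m) = trans (sum-cong-≗ {n} (λ _ → sumAll-zero m)) (sum-replicate-zero n)

  *-distribˡ-sumAll : ∀ m c (F : Vec (Fin n) m → ℚ) → c * sumAll m F ≡ sumAll m (λ v → c * F v)
  *-distribˡ-sumAll zero    c F = refl
  *-distribˡ-sumAll (suc m) c F =
    trans (*-distribˡ-sum c (λ x → sumAll m (λ v → F (x ∷ v)))) (sum-cong-≗ (λ x → *-distribˡ-sumAll m c (λ v → F (x ∷ v))))

  *-distribʳ-sumAll : ∀ m c (F : Vec (Fin n) m → ℚ) → sumAll m F * c ≡ sumAll m (λ v → F v * c)
  *-distribʳ-sumAll zero    c F = refl
  *-distribʳ-sumAll (suc m) c F =
    trans (*-distribʳ-sum c (λ x → sumAll m (λ v → F (x ∷ v)))) (sum-cong-≗ (λ x → *-distribʳ-sumAll m c (λ v → F (x ∷ v))))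

  sumAll-sum-comm : ∀ {k} m (F : Fin k → Vec (Fin n) m → ℚ) →
                    sumAll m (λ v → sum (λ i → F i v)) ≡ sum (λ i → sumAll m (F i))
  sumAll-sum-comm zero    F = refl
  sumAll-sum-comm (suc m) F =
    trans (sum-cong-≗ (λ x → sumAll-sum-comm m (λ i v → F i (x ∷ v)))) (∑-comm (λ x i → sumAll m (λ v → F i (x ∷ v))))

  sumAll-nonNeg : ∀ m (F : Vec (Fin n) m → ℚ) → (∀ v → 0ℚ ≤ F v) → 0ℚ ≤ sumAll m F
  sumAll-nonNeg zero    F F≥0 = F≥0 []
  sumAll-nonNeg (suc m) F F≥0 = sum-nonNeg _ (λ x → sumAll-nonNeg m _ (λ v → F≥0 (x ∷ v)))

  sumAll-mono-≤ : ∀ m (F G : Vec (Fin n) m → ℚ) → (∀ v → F v ≤ G v) → sumAll m F ≤ sumAll m G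
  sumAll-mono-≤ zero    F G F≤G = F≤G []
  sumAll-mono-≤ (suc m) F G F≤G = sum-mono-≤ _ _ (λ x → sumAll-mono-≤ m _ _ (λ v → F≤G (x ∷ v)))

  term≤sumAll : ∀ m (F : Vec (Fin n) m → ℚ) → (∀ v → 0ℚ ≤ F v) → ∀ v → F v ≤ sumAll m F
  term≤sumAll zero    F F≥0 [] = ℚₚ.≤-refl
  term≤sumAll (suc m) F F≥0 (x ∷ v) = ℚₚ.≤-trans (term≤sumAll m (λ w → F (x ∷ w)) (λ w → F≥0 (x ∷ w)) v)
    (term≤sum _ (λ y → sumAll-nonNeg m _ (λ w → F≥0 (y ∷ w))) x)

  sumAll-prod : ∀ m (c : Fin m → Fin n → ℚ) → sumAll m (λ v → prod (λ j → c j (lookup v j))) ≡ prod (λ j → sum (c j))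
  sumAll-prod zero    c = refl
  sumAll-prod (suc m) c = begin
    sum (λ x → sumAll m (λ v → c zero x * prod (λ j → c (suc j) (lookup v j))))
      ≡⟨ sum-cong-≗ (λ x → sym (*-distribˡ-sumAll m (c zero x) _)) ⟩
    sum (λ x → c zero x * sumAll m (λ v → prod (λ j → c (suc j) (lookup v j))))
      ≡⟨ sum-cong-≗ (λ x → cong (c zero x *_) (sumAll-prod m (λ j → c (suc j)))) ⟩
    sum (λ x → c zero x * prod (λ j → sum (c (suc j))))
      ≡⟨ *-distribʳ-sum _ (c zero) ⟨
    sum (c zero) * prod (λ j → sum (c (suc j))) ∎
    where open ≡-Reasoning

  sumAll-update : ∀ m (i : Fin m) (u w : Fin n) (F : Vec (Fin n) m → ℚ) →
    sumAll m (λ v → 𝟙 (lookup v i Finₚ.≟ u) * F v) ≡ sumAll m (λ v → 𝟙 (lookup v i Finₚ.≟ w) * F (v [ i ]≔ u))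
  sumAll-update (suc m) zero u w F = begin
    sum (λ x → sumAll m (λ v → 𝟙 (x Finₚ.≟ u) * F (x ∷ v)))
      ≡⟨ sum-cong-≗ (λ x → sym (*-distribˡ-sumAll m (𝟙 (x Finₚ.≟ u)) _)) ⟩
    sum (λ x → 𝟙 (x Finₚ.≟ u) * sumAll m (λ v → F (x ∷ v)))
      ≡⟨ sum-δ u _ ⟩
    sumAll m (λ v → F (u ∷ v))
      ≡⟨ sum-δ w (λ _ → sumAll m (λ v → F (u ∷ v))) ⟨
    sum (λ x → 𝟙 (x Finₚ.≟ w) * sumAll m (λ v → F (u ∷ v)))
      ≡⟨ sum-cong-≗ (λ x → *-distribˡ-sumAll m (𝟙 (x Finₚ.≟ w)) _) ⟩
    sum (λ x → sumAll m (λ v → 𝟙 (x Finₚ.≟ w) * F (u ∷ v))) ∎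
    where open ≡-Reasoning
  sumAll-update (suc m) (suc i) u w F = sum-cong-≗ (λ x → sumAll-update m i u w (λ v → F (x ∷ v)))

fromℕ : ℕ → ℚ
fromℕ m = + m / 1

record IsInteger (q : ℚ) : Set where
  constructor isInteger
  field ↧ₙ≡1 : ↧ₙ q ≡ 1

fromℚᵘ-+ : ∀ a b → ℚ.fromℚᵘ a + ℚ.fromℚᵘ b ≡ ℚ.fromℚᵘ (a ℚᵘ.+ b)
fromℚᵘ-+ a b = ℚₚ.toℚᵘ-injective (ℚᵘₚ.≃-trans (ℚₚ.toℚᵘ-homo-+ (ℚ.fromℚᵘ a) (ℚ.fromℚᵘ b))
  (ℚᵘₚ.≃-trans (ℚᵘₚ.+-cong (ℚₚ.toℚᵘ-fromℚᵘ a) (ℚₚ.toℚᵘ-fromℚᵘ b)) (ℚᵘₚ.≃-sym (ℚₚ.toℚᵘ-fromℚᵘ (a ℚᵘ.+ b)))))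

fromℚᵘ-* : ∀ a b → ℚ.fromℚᵘ a * ℚ.fromℚᵘ b ≡ ℚ.fromℚᵘ (a ℚᵘ.* b)
fromℚᵘ-* a b = ℚₚ.toℚᵘ-injective (ℚᵘₚ.≃-trans (ℚₚ.toℚᵘ-homo-* (ℚ.fromℚᵘ a) (ℚ.fromℚᵘ b))
  (ℚᵘₚ.≃-trans (ℚᵘₚ.*-cong (ℚₚ.toℚᵘ-fromℚᵘ a) (ℚₚ.toℚᵘ-fromℚᵘ b)) (ℚᵘₚ.≃-sym (ℚₚ.toℚᵘ-fromℚᵘ (a ℚᵘ.* b)))))

fromℕ-+ : ∀ a b → fromℕ a + fromℕ b ≡ fromℕ (a ℕ.+ b)
fromℕ-+ a b = trans (fromℚᵘ-+ (mkℚᵘ (+ a) 0) (mkℚᵘ (+ b) 0))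
  (ℚₚ.fromℚᵘ-cong {mkℚᵘ (+ a) 0 ℚᵘ.+ mkℚᵘ (+ b) 0} {mkℚᵘ (+ (a ℕ.+ b)) 0} (ℚᵘ.*≡* (begin
  (+ a ℤ.* + 1 ℤ.+ + b ℤ.* + 1) ℤ.* + 1  ≡⟨ ℤₚ.*-identityʳ _ ⟩
  + a ℤ.* + 1 ℤ.+ + b ℤ.* + 1            ≡⟨ cong₂ ℤ._+_ (ℤₚ.*-identityʳ (+ a)) (ℤₚ.*-identityʳ (+ b)) ⟩
  + (a ℕ.+ b)                            ≡⟨ ℤₚ.*-identityʳ _ ⟨
  + (a ℕ.+ b) ℤ.* + 1                    ∎)))
  where open ≡-Reasoning

fromℕ-* : ∀ a b → fromℕ a * fromℕ b ≡ fromℕ (a ℕ.* b)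
fromℕ-* a b = trans (fromℚᵘ-* (mkℚᵘ (+ a) 0) (mkℚᵘ (+ b) 0))
  (ℚₚ.fromℚᵘ-cong {mkℚᵘ (+ a) 0 ℚᵘ.* mkℚᵘ (+ b) 0} {mkℚᵘ (+ (a ℕ.* b)) 0} (ℚᵘ.*≡* (cong (ℤ._* + 1) (sym (ℤₚ.pos-* a b)))))

/suc*fromℕ : ∀ m → (+ 1 / suc m) * fromℕ (suc m) ≡ 1ℚ
/suc*fromℕ m = trans (fromℚᵘ-* (mkℚᵘ (+ 1) m) (mkℚᵘ (+ suc m) 0))
  (ℚₚ.fromℚᵘ-cong {mkℚᵘ (+ 1) m ℚᵘ.* mkℚᵘ (+ suc m) 0} {mkℚᵘ (+ 1) 0} (ℚᵘ.*≡* (cong +_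
    (trans (ℕₚ.*-identityʳ _) (trans (ℕₚ.*-identityˡ (suc m)) (sym (trans (ℕₚ.*-identityˡ _) (ℕₚ.*-identityʳ (suc m)))))))))

fromℕ-prod : ∀ {n} (m : Fin n → ℕ) → fromℕ (prodFin m) ≡ prod (λ j → fromℕ (m j))
fromℕ-prod {zero}  m = refl
fromℕ-prod {suc n} m = trans (sym (fromℕ-* (m zero) (prodFin (λ j → m (suc j))))) (cong (fromℕ (m zero) *_) (fromℕ-prod (λ j → m (suc j))))

sum-ones : ∀ n → sum {n} (λ _ → 1ℚ) ≡ fromℕ n
sum-ones zero    = refl
sum-ones (suc n) = trans (cong (_+_ 1ℚ) (sum-ones n)) (fromℕ-+ 1 n)

fromℕ-pos : ∀ m → 0 ℕ.< m → 0ℚ < fromℕ m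
fromℕ-pos (suc m) _ = ℚₚ.toℚᵘ-cancel-<
  (ℚᵘₚ.<-respʳ-≃ (ℚᵘₚ.≃-sym (ℚₚ.toℚᵘ-fromℚᵘ (mkℚᵘ (+ suc m) 0))) (ℚᵘ.*<* (ℤ.+<+ (s≤s z≤n))))

fromℕ-cancel-≤ : ∀ {a b} → fromℕ a ≤ fromℕ b → a ℕ.≤ b
fromℕ-cancel-≤ {a} {b} a≤b
  with ℚᵘₚ.≤-respʳ-≃ (ℚₚ.toℚᵘ-fromℚᵘ (mkℚᵘ (+ b) 0)) (ℚᵘₚ.≤-respˡ-≃ (ℚₚ.toℚᵘ-fromℚᵘ (mkℚᵘ (+ a) 0)) (ℚₚ.toℚᵘ-mono-≤ a≤b))
... | ℚᵘ.*≤* a*1≤b*1 = ℤₚ.drop‿+≤+ (subst₂ ℤ._≤_ (ℤₚ.*-identityʳ (+ a)) (ℤₚ.*-identityʳ (+ b)) a*1≤b*1)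

↧*≡1⇒isInteger : ∀ {q} (b : ℤ) → ↧ q ℤ.* b ≡ + 1 → IsInteger q
↧*≡1⇒isInteger {q} b ab≡1 = isInteger (ℕₚ.m*n≡1⇒m≡1 (↧ₙ q) ℤ.∣ b ∣ (trans (sym (ℤₚ.abs-* (↧ q) b)) (cong ℤ.∣_∣ ab≡1)))

isInteger-+ : ∀ {p q} → IsInteger p → IsInteger q → IsInteger (p + q)
isInteger-+ {p} {q} (isInteger p∈ℤ) (isInteger q∈ℤ) = ↧*≡1⇒isInteger _ (trans (ℚₚ.↧-+ p q) (cong₂ (λ a b → + a ℤ.* + b) p∈ℤ q∈ℤ))

isInteger-* : ∀ {p q} → IsInteger p → IsInteger q → IsInteger (p * q)
isInteger-* {p} {q} (isInteger p∈ℤ) (isInteger q∈ℤ) = ↧*≡1⇒isInteger _ (trans (ℚₚ.↧-* p q) (cong₂ (λ a b → + a ℤ.* + b) p∈ℤ q∈ℤ))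

isInteger-/1 : ∀ z → IsInteger (z / 1)
isInteger-/1 z = ↧*≡1⇒isInteger _ (ℚₚ.↧-/ z 1)

isInteger-𝟙 : ∀ {p} {P : Set p} (d : Dec P) → IsInteger (𝟙 d)
isInteger-𝟙 (yes _) = isInteger refl
isInteger-𝟙 (no _)  = isInteger refl

isInteger-sum : ∀ {n} (f : Fin n → ℚ) → (∀ i → IsInteger (f i)) → IsInteger (sum f)
isInteger-sum {zero}  f _   = isInteger refl
isInteger-sum {suc n} f f∈ℤ = isInteger-+ (f∈ℤ zero) (isInteger-sum (λ i → f (suc i)) (λ i → f∈ℤ (suc i)))

isInteger-prod : ∀ {n} (f : Fin n → ℚ) → (∀ i → IsInteger (f i)) → IsInteger (prod f)
isInteger-prod {zero}  f _   = isInteger refl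
isInteger-prod {suc n} f f∈ℤ = isInteger-* (f∈ℤ zero) (isInteger-prod (λ i → f (suc i)) (λ i → f∈ℤ (suc i)))

isInteger-sumAll : ∀ {n} m (F : Vec (Fin n) m → ℚ) → (∀ v → IsInteger (F v)) → IsInteger (sumAll m F)
isInteger-sumAll zero    F F∈ℤ = F∈ℤ []
isInteger-sumAll (suc m) F F∈ℤ = isInteger-sum _ (λ x → isInteger-sumAll m _ (λ v → F∈ℤ (x ∷ v)))

isInteger-fromℕ-* : ∀ m q → ↧ₙ q ∣ m → IsInteger (fromℕ m * q)
isInteger-fromℕ-* m q (divides k m≡k*d) = subst IsInteger (sym m*q≡) (isInteger-/1 (+ k ℤ.* ↥ q))
  where
  d = ↧ₙ q
  m*q≡ : fromℕ m * q ≡ (+ k ℤ.* ↥ q) / 1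
  m*q≡ = begin
    fromℕ m * q
      ≡⟨ cong (fromℕ m *_) (ℚₚ.↥p/↧p≡p q) ⟨
    fromℕ m * (↥ q / d)
      ≡⟨ fromℚᵘ-* (mkℚᵘ (+ m) 0) (mkℚᵘ (↥ q) (ℚ.ℚ.denominator-1 q)) ⟩
    ℚ.fromℚᵘ (mkℚᵘ (+ m) 0 ℚᵘ.* mkℚᵘ (↥ q) (ℚ.ℚ.denominator-1 q))
      ≡⟨ ℚₚ.fromℚᵘ-cong {mkℚᵘ (+ m) 0 ℚᵘ.* mkℚᵘ (↥ q) (ℚ.ℚ.denominator-1 q)} {mkℚᵘ (+ k ℤ.* ↥ q) 0} (ℚᵘ.*≡* cross) ⟩
    (+ k ℤ.* ↥ q) / 1 ∎
    where
    open ≡-Reasoning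
    cross : (+ m ℤ.* ↥ q) ℤ.* + 1 ≡ (+ k ℤ.* ↥ q) ℤ.* + (1 ℕ.* d)
    cross = begin
      (+ m ℤ.* ↥ q) ℤ.* + 1          ≡⟨ ℤₚ.*-identityʳ _ ⟩
      + m ℤ.* ↥ q                    ≡⟨ cong (λ x → + x ℤ.* ↥ q) m≡k*d ⟩
      + (k ℕ.* d) ℤ.* ↥ q            ≡⟨ cong (ℤ._* ↥ q) (ℤₚ.pos-* k d) ⟩
      + k ℤ.* + d ℤ.* ↥ q            ≡⟨ ℤₚ.*-assoc (+ k) (+ d) (↥ q) ⟩
      + k ℤ.* (+ d ℤ.* ↥ q)          ≡⟨ cong (+ k ℤ.*_) (ℤₚ.*-comm (+ d) (↥ q)) ⟩
      + k ℤ.* (↥ q ℤ.* + d)          ≡⟨ ℤₚ.*-assoc (+ k) (↥ q) (+ d) ⟨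
      (+ k ℤ.* ↥ q) ℤ.* + d          ≡⟨ cong (λ x → (+ k ℤ.* ↥ q) ℤ.* + x) (ℕₚ.*-identityˡ d) ⟨
      (+ k ℤ.* ↥ q) ℤ.* + (1 ℕ.* d)  ∎

positiveInteger : ∀ q → IsInteger q → 0ℚ < q → ∃[ m ] (ℤ.∣ ↥ q ∣ ≡ suc m × q ≡ fromℕ (suc m))
positiveInteger q@(mkℚ (+ suc m) _ _) (isInteger q∈ℤ) _ =
  m , refl , trans (sym (ℚₚ.↥p/↧p≡p q)) (ℚₚ./-cong {↥ q} {↧ₙ q} {↥ q} {1} refl q∈ℤ)
positiveInteger (mkℚ (+ zero)   _ _) _ (ℚ.*<* (ℤ.+<+ ()))
positiveInteger (mkℚ -[1+ _ ]   _ _) _ (ℚ.*<* ())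

↧ₙ-coprime-↥ : ∀ q → Coprime (↧ₙ q) ℤ.∣ ↥ q ∣
↧ₙ-coprime-↥ (mkℚ _ _ coprime) = Coprimality.sym (Coprimality.recompute coprime)

-- Writing q = a / d in lowest terms, d ∣ a s forces d ∣ s by coprimality.
↧ₙ-∣ : ∀ q s → IsInteger s → IsInteger (q * s) → ↧ₙ q ∣ ℤ.∣ ↥ s ∣
↧ₙ-∣ q s (isInteger s∈ℤ) (isInteger qs∈ℤ) = coprime-divisor (↧ₙ-coprime-↥ q) (divides ℤ.∣ ↥ (q * s) ∣ (sym (cross (ℚₚ.↧-* q s) (ℚₚ.↥-* q s))))
  where
  open ≡-Reasoning
  cross : ∀ {g} → ↧ (q * s) ℤ.* g ≡ ↧ q ℤ.* ↧ s → ↥ (q * s) ℤ.* g ≡ ↥ q ℤ.* ↥ s →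
          ℤ.∣ ↥ (q * s) ∣ ℕ.* ↧ₙ q ≡ ℤ.∣ ↥ q ∣ ℕ.* ℤ.∣ ↥ s ∣
  cross {g} ↧-eq ↥-eq = begin
    ℤ.∣ ↥ (q * s) ∣ ℕ.* ↧ₙ q      ≡⟨ ℤₚ.abs-* (↥ (q * s)) (↧ q) ⟨
    ℤ.∣ ↥ (q * s) ℤ.* ↧ q ∣       ≡⟨ cong (λ x → ℤ.∣ ↥ (q * s) ℤ.* x ∣) g≡↧q ⟨
    ℤ.∣ ↥ (q * s) ℤ.* g ∣         ≡⟨ cong ℤ.∣_∣ ↥-eq ⟩
    ℤ.∣ ↥ q ℤ.* ↥ s ∣             ≡⟨ ℤₚ.abs-* (↥ q) (↥ s) ⟩
    ℤ.∣ ↥ q ∣ ℕ.* ℤ.∣ ↥ s ∣       ∎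
    where
    g≡↧q : g ≡ ↧ q
    g≡↧q = begin
      g                  ≡⟨ ℤₚ.*-identityˡ g ⟨
      + 1 ℤ.* g          ≡⟨ cong (λ x → + x ℤ.* g) qs∈ℤ ⟨
      ↧ (q * s) ℤ.* g    ≡⟨ ↧-eq ⟩
      ↧ q ℤ.* ↧ s        ≡⟨ cong (λ x → ↧ q ℤ.* + x) s∈ℤ ⟩
      ↧ q ℤ.* + 1        ≡⟨ ℤₚ.*-identityʳ (↧ q) ⟩
      ↧ q                ∎

denominator-bound : ∀ q s B → IsInteger s → IsInteger (q * s) → 0ℚ < s → s ≤ fromℕ B → ↧ₙ q ℕ.≤ B
denominator-bound q s B s∈ℤ qs∈ℤ s>0 s≤B with positiveInteger s s∈ℤ s>0
... | m , ∣↥s∣≡ , s≡ = ℕₚ.≤-trans (∣⇒≤ (subst (↧ₙ q ∣_) ∣↥s∣≡ (↧ₙ-∣ q s s∈ℤ qs∈ℤ)))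
                                   (fromℕ-cancel-≤ (subst (_≤ fromℕ B) s≡ s≤B))

module _ where
  open ≡-Reasoning

  converges-cong : ∀ {x y : ℕ → ℚ} {q} → (∀ N → x N ≡ y N) → ConvergesTo x q → ConvergesTo y q
  converges-cong x≗y x→q ε ε>0 with x→q ε ε>0
  ... | N₀ , close = N₀ , λ N N≥N₀ → subst (λ z → ∣ z - _ ∣ < ε) (x≗y N) (close N N≥N₀)

  converges-const : ∀ q → ConvergesTo (λ _ → q) q
  converges-const q ε ε>0 = 0 , λ _ _ → subst (λ z → ∣ z ∣ < ε) (sym (ℚₚ.+-inverseʳ q)) ε>0

  converges-+ : ∀ {x y : ℕ → ℚ} {p q} → ConvergesTo x p → ConvergesTo y q → ConvergesTo (λ N → x N + y N) (p + q)
  converges-+ {x} {y} {p} {q} x→p y→q ε ε>0 with x→p (ε * ½) (*-pos ε>0 (ℚₚ.positive⁻¹ ½)) | y→q (ε * ½) (*-pos ε>0 (ℚₚ.positive⁻¹ ½))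
  ... | N₁ , close₁ | N₂ , close₂ = N₁ ⊔ N₂ , λ N N≥ → ℚₚ.≤-<-trans (ℚₚ.≤-reflexive (cong ∣_∣ (regroup N)))
    (ℚₚ.≤-<-trans (ℚₚ.∣p+q∣≤∣p∣+∣q∣ (x N - p) (y N - q))
      (subst (∣ x N - p ∣ + ∣ y N - q ∣ <_) halves
        (ℚₚ.+-mono-< (close₁ N (ℕₚ.≤-trans (ℕₚ.m≤m⊔n N₁ N₂) N≥)) (close₂ N (ℕₚ.≤-trans (ℕₚ.m≤n⊔m N₁ N₂) N≥)))))
    where
    regroup : ∀ N → x N + y N - (p + q) ≡ (x N - p) + (y N - q)
    regroup N = solve 4 (λ a b c d → a :+ b :- (c :+ d) := (a :- c) :+ (b :- d)) refl (x N) (y N) p q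
    halves : ε * ½ + ε * ½ ≡ ε
    halves = solve 1 (λ e → e :* con ½ :+ e :* con ½ := e) refl ε

  -- Scale the tolerance by 1 / (∣c∣ + 1) to avoid dividing by c.
  converges-*ˡ : ∀ {x : ℕ → ℚ} {p} c → ConvergesTo x p → ConvergesTo (λ N → c * x N) (c * p)
  converges-*ˡ {x} {p} c x→p ε ε>0 = shrink (x→p (ε * 1/ K) (*-pos ε>0 (ℚₚ.positive⁻¹ (1/ K) {{ℚₚ.1/pos⇒pos K}})))
    where
    K = ∣ c ∣ + 1ℚ
    instance
      K>0 : ℚ.Positive K
      K>0 = ℚ.positive (ℚₚ.≤-<-trans (ℚₚ.0≤∣p∣ c) (subst (_< K) (ℚₚ.+-identityʳ ∣ c ∣) (ℚₚ.+-monoʳ-< ∣ c ∣ 0<1)))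
      K≢0 : ℚ.NonZero K
      K≢0 = ℚₚ.pos⇒nonZero K
    ∣c∣≤K : ∣ c ∣ ≤ K
    ∣c∣≤K = subst (_≤ K) (ℚₚ.+-identityʳ ∣ c ∣) (ℚₚ.+-monoʳ-≤ ∣ c ∣ 0≤1)
    distance : ∀ N → ∣ c * x N - c * p ∣ ≡ ∣ c ∣ * ∣ x N - p ∣
    distance N = begin
      ∣ c * x N - c * p ∣   ≡⟨ cong ∣_∣ (solve 3 (λ c a b → c :* a :- c :* b := c :* (a :- b)) refl c (x N) p) ⟩
      ∣ c * (x N - p) ∣     ≡⟨ ℚₚ.∣p*q∣≡∣p∣*∣q∣ c (x N - p) ⟩
      ∣ c ∣ * ∣ x N - p ∣   ∎
    Kδ≡ε : K * (ε * 1/ K) ≡ ε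
    Kδ≡ε = trans (solve 3 (λ k e y → k :* (e :* y) := e :* (y :* k)) refl K ε (1/ K))
                 (trans (cong (ε *_) (ℚₚ.*-inverseˡ K)) (ℚₚ.*-identityʳ ε))
    shrink : ∃[ N₀ ] (∀ N → N₀ ℕ.≤ N → ∣ x N - p ∣ < ε * 1/ K) → ∃[ N₀ ] (∀ N → N₀ ℕ.≤ N → ∣ c * x N - c * p ∣ < ε)
    shrink (N₀ , close) = N₀ , λ N N≥N₀ → ℚₚ.≤-<-trans (ℚₚ.≤-reflexive (distance N))
      (ℚₚ.≤-<-trans (ℚₚ.*-monoʳ-≤-nonNeg ∣ x N - p ∣ {{ℚ.nonNegative (ℚₚ.0≤∣p∣ (x N - p))}} ∣c∣≤K)
        (subst (K * ∣ x N - p ∣ <_) Kδ≡ε (ℚₚ.*-monoʳ-<-pos K (close N N≥N₀))))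

  converges-*ʳ : ∀ {x : ℕ → ℚ} {p} c → ConvergesTo x p → ConvergesTo (λ N → x N * c) (p * c)
  converges-*ʳ {x} {p} c x→p =
    subst (ConvergesTo (λ N → x N * c)) (ℚₚ.*-comm c p) (converges-cong (λ N → ℚₚ.*-comm c (x N)) (converges-*ˡ c x→p))

  converges-neg : ∀ {x : ℕ → ℚ} {p} → ConvergesTo x p → ConvergesTo (λ N → - x N) (- p)
  converges-neg {x} {p} x→p ε ε>0 with x→p ε ε>0
  ... | N₀ , close = N₀ , λ N N≥N₀ → subst (_< ε) (begin
    ∣ x N - p ∣       ≡⟨ ℚₚ.∣-p∣≡∣p∣ (x N - p) ⟨
    ∣ - (x N - p) ∣   ≡⟨ cong ∣_∣ (solve 2 (λ a b → :- (a :- b) := :- a :- :- b) refl (x N) p) ⟩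
    ∣ - x N - - p ∣   ∎) (close N N≥N₀)

  converges-- : ∀ {x y : ℕ → ℚ} {p q} → ConvergesTo x p → ConvergesTo y q → ConvergesTo (λ N → x N - y N) (p - q)
  converges-- {x} {y} x→p y→q = converges-+ {x} {λ N → - y N} x→p (converges-neg {y} y→q)

  converges-sum : ∀ {n} {F : Fin n → ℕ → ℚ} {q : Fin n → ℚ} →
                  (∀ i → ConvergesTo (F i) (q i)) → ConvergesTo (λ N → sum (λ i → F i N)) (sum q)
  converges-sum {zero}  _     = converges-const 0ℚ
  converges-sum {suc n} {F} F→q =
    converges-+ {F zero} {λ N → sum (λ i → F (suc i) N)} (F→q zero) (converges-sum (λ i → F→q (suc i)))

  -- For N ≥ d, where ε = a / d with a ≥ 1, we have 1 / (N + 1) < 1 / d ≤ ε.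
  1/suc→0 : ConvergesTo (λ N → + 1 / suc N) 0ℚ
  1/suc→0 ε@(mkℚ (+ suc a) _ _) _ = ↧ₙ ε , λ N N≥d →
    subst (_< ε) (sym (trans (cong ∣_∣ (ℚₚ.+-identityʳ _)) (ℚₚ.0≤p⇒∣p∣≡p (ℚₚ.<⇒≤ (1/suc>0 N))))) (below N N≥d)
    where
    1/suc>0 : ∀ N → 0ℚ < + 1 / suc N
    1/suc>0 N = ℚₚ.toℚᵘ-cancel-< (ℚᵘₚ.<-respʳ-≃ (ℚᵘₚ.≃-sym (ℚₚ.toℚᵘ-fromℚᵘ (mkℚᵘ (+ 1) N))) (ℚᵘ.*<* (ℤ.+<+ (s≤s z≤n))))
    below : ∀ N → ↧ₙ ε ℕ.≤ N → + 1 / suc N < ε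
    below N N≥d = ℚₚ.toℚᵘ-cancel-< (ℚᵘₚ.<-respˡ-≃ (ℚᵘₚ.≃-sym (ℚₚ.toℚᵘ-fromℚᵘ (mkℚᵘ (+ 1) N))) (ℚᵘ.*<*
      (subst₂ ℤ._<_ (sym (ℤₚ.*-identityˡ (+ ↧ₙ ε))) (ℤₚ.pos-* (suc a) (suc N))
        (ℤ.+<+ (ℕₚ.≤-trans (s≤s N≥d) (ℕₚ.m≤n*m (suc N) (suc a)))))))
  1/suc→0 (mkℚ (+ zero)  _ _) (ℚ.*<* (ℤ.+<+ ()))
  1/suc→0 (mkℚ -[1+ _ ]  _ _) (ℚ.*<* ())

module Gain {n : ℕ} (P : Matrix n) (r : Fin n → ℤ) (w : Fin n → ℚ)
            (w-invariant : ∀ k → sum (λ i → w i * P i k) ≡ w k) (mass>0 : 0ℚ < sum w) where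

  open ≡-Reasoning

  mass reward : ℚ
  mass   = sum w
  reward = sum (λ i → w i * toℚ r i)

  instance
    mass≢0 : ℚ.NonZero mass
    mass≢0 = ℚ.>-nonZero mass>0

  gain : ℚ
  gain = reward * 1/ mass

  weighted-powVec : ∀ k v → sum (λ i → w i * powVec k P v i) ≡ sum (λ i → w i * v i)
  weighted-powVec zero    v = refl
  weighted-powVec (suc k) v = trans (begin
    sum (λ i → w i * Σ (λ j → P i j * u j))        ≡⟨ sum-cong-≗ (λ i → cong (w i *_) (Σ≡sum (λ j → P i j * u j))) ⟩
    sum (λ i → w i * sum (λ j → P i j * u j))      ≡⟨ sum-cong-≗ (λ i → *-distribˡ-sum (w i) (λ j → P i j * u j)) ⟩
    sum (λ i → sum (λ j → w i * (P i j * u j)))    ≡⟨ ∑-comm (λ i j → w i * (P i j * u j)) ⟩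
    sum (λ j → sum (λ i → w i * (P i j * u j)))    ≡⟨ sum-cong-≗ (λ j → sum-cong-≗ (λ i → sym (ℚₚ.*-assoc (w i) (P i j) (u j)))) ⟩
    sum (λ j → sum (λ i → w i * P i j * u j))      ≡⟨ sum-cong-≗ (λ j → *-distribʳ-sum (u j) (λ i → w i * P i j)) ⟨
    sum (λ j → sum (λ i → w i * P i j) * u j)      ≡⟨ sum-cong-≗ (λ j → cong (_* u j) (w-invariant j)) ⟩
    sum (λ j → w j * u j)                          ∎) (weighted-powVec k v)
    where
    u = powVec k P v

  weighted-expectedReward : ∀ N → sum (λ i → w i * expectedReward P r N i) ≡ fromℕ (suc N) * reward
  weighted-expectedReward zero    = sym (ℚₚ.*-identityˡ reward)
  weighted-expectedReward (suc N) = begin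
    sum (λ i → w i * (expectedReward P r N i + powVec (suc N) P (toℚ r) i))
      ≡⟨ sum-cong-≗ (λ i → ℚₚ.*-distribˡ-+ (w i) _ _) ⟩
    sum (λ i → w i * expectedReward P r N i + w i * powVec (suc N) P (toℚ r) i)
      ≡⟨ ∑-distrib-+ (λ i → w i * expectedReward P r N i) (λ i → w i * powVec (suc N) P (toℚ r) i) ⟩
    sum (λ i → w i * expectedReward P r N i) + sum (λ i → w i * powVec (suc N) P (toℚ r) i)
      ≡⟨ cong₂ _+_ (weighted-expectedReward N) (weighted-powVec (suc N) (toℚ r)) ⟩
    fromℕ (suc N) * reward + reward
      ≡⟨ cong (_+_ (fromℕ (suc N) * reward)) (ℚₚ.*-identityˡ reward) ⟨
    fromℕ (suc N) * reward + 1ℚ * reward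
      ≡⟨ ℚₚ.*-distribʳ-+ reward (fromℕ (suc N)) 1ℚ ⟨
    (fromℕ (suc N) + fromℕ 1) * reward
      ≡⟨ cong (_* reward) (trans (fromℕ-+ (suc N) 1) (cong fromℕ (ℕₚ.+-comm (suc N) 1))) ⟩
    fromℕ (suc (suc N)) * reward ∎

  weighted-avgReward : ∀ N → sum (λ i → w i * avgReward P r N i) ≡ reward + (+ 1 / suc N) * reward
  weighted-avgReward N = begin
    sum (λ i → w i * (ε * expectedReward P r (suc N) i))
      ≡⟨ sum-cong-≗ (λ i → solve 3 (λ a b c → a :* (b :* c) := b :* (a :* c)) refl (w i) ε (expectedReward P r (suc N) i)) ⟩
    sum (λ i → ε * (w i * expectedReward P r (suc N) i))
      ≡⟨ *-distribˡ-sum ε (λ i → w i * expectedReward P r (suc N) i) ⟨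
    ε * sum (λ i → w i * expectedReward P r (suc N) i)
      ≡⟨ cong (ε *_) (weighted-expectedReward (suc N)) ⟩
    ε * (fromℕ (suc (suc N)) * reward)
      ≡⟨ cong (λ x → ε * (x * reward)) (fromℕ-+ 1 (suc N)) ⟨
    ε * ((1ℚ + fromℕ (suc N)) * reward)
      ≡⟨ solve 3 (λ e m ρ → e :* ((con 1ℚ :+ m) :* ρ) := (e :* m) :* ρ :+ e :* ρ) refl ε (fromℕ (suc N)) reward ⟩
    ε * fromℕ (suc N) * reward + ε * reward
      ≡⟨ cong (λ x → x * reward + ε * reward) (/suc*fromℕ N) ⟩
    1ℚ * reward + ε * reward
      ≡⟨ cong (_+ ε * reward) (ℚₚ.*-identityˡ reward) ⟩
    reward + ε * reward ∎
    where
    ε = + 1 / suc N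

  -- Pairing with w gives mass · aᵢ = (∑ⱼ wⱼ aⱼ) − ∑ⱼ wⱼ (aⱼ − aᵢ).
  avgReward-decomposition : ∀ i N → avgReward P r N i
    ≡ 1/ mass * (reward + (+ 1 / suc N) * reward - sum (λ j → w j * (avgReward P r N j - avgReward P r N i)))
  avgReward-decomposition i N = sym (begin
    1/ mass * (X - sum (λ j → w j * (a j - a i)))
      ≡⟨ cong (λ y → 1/ mass * (X - y)) deviations ⟩
    1/ mass * (X - (X + mass * - a i))
      ≡⟨ solve 4 (λ u x a m → u :* (x :- (x :+ m :* (:- a))) := (m :* u) :* a) refl (1/ mass) X (a i) mass ⟩
    mass * 1/ mass * a i
      ≡⟨ cong (_* a i) (ℚₚ.*-inverseʳ mass) ⟩
    1ℚ * a i
      ≡⟨ ℚₚ.*-identityˡ (a i) ⟩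
    a i ∎)
    where
    a : Fin n → ℚ
    a j = avgReward P r N j
    X = reward + (+ 1 / suc N) * reward
    deviations : sum (λ j → w j * (a j - a i)) ≡ X + mass * - a i
    deviations = begin
      sum (λ j → w j * (a j - a i))               ≡⟨ sum-cong-≗ (λ j → ℚₚ.*-distribˡ-+ (w j) (a j) (- a i)) ⟩
      sum (λ j → w j * a j + w j * - a i)         ≡⟨ ∑-distrib-+ (λ j → w j * a j) (λ j → w j * - a i) ⟩
      sum (λ j → w j * a j) + sum (λ j → w j * - a i) ≡⟨ cong₂ _+_ (weighted-avgReward N) (sym (*-distribʳ-sum (- a i) w)) ⟩
      X + mass * - a i                            ∎

  avgReward→gain : (∀ i j → ConvergesTo (λ N → avgReward P r N i - avgReward P r N j) 0ℚ) →
                   ∀ i → ConvergesTo (λ N → avgReward P r N i) gain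
  avgReward→gain a→same i = subst (ConvergesTo (λ N → avgReward P r N i)) limit
    (converges-cong (λ N → sym (avgReward-decomposition i N))
      (converges-*ˡ (1/ mass) (converges-- {λ N → reward + (+ 1 / suc N) * reward} {deviation} total→ deviation→0)))
    where
    total→ : ConvergesTo (λ N → reward + (+ 1 / suc N) * reward) (reward + 0ℚ * reward)
    total→ = converges-+ {λ _ → reward} {λ N → (+ 1 / suc N) * reward}
               (converges-const reward) (converges-*ʳ {λ N → + 1 / suc N} {0ℚ} reward 1/suc→0)
    deviation : ℕ → ℚ
    deviation N = sum (λ j → w j * (avgReward P r N j - avgReward P r N i))
    deviation→0 : ConvergesTo deviation (sum (λ j → w j * 0ℚ))
    deviation→0 = converges-sum (λ j → converges-*ˡ (w j) (a→same j i))
    limit : 1/ mass * (reward + 0ℚ * reward - sum (λ j → w j * 0ℚ)) ≡ gain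
    limit = begin
      1/ mass * (reward + 0ℚ * reward - sum (λ j → w j * 0ℚ))
        ≡⟨ cong (λ z → 1/ mass * (reward + 0ℚ * reward - z)) (trans (sum-cong-≗ (λ j → ℚₚ.*-zeroʳ (w j))) (sum-replicate-zero n)) ⟩
      1/ mass * (reward + 0ℚ * reward - 0ℚ)
        ≡⟨ solve 2 (λ u ρ → u :* (ρ :+ con 0ℚ :* ρ :- con 0ℚ) := ρ :* u) refl (1/ mass) reward ⟩
      gain ∎

  gain-denominator : ∀ Λ .{{_ : ℕ.NonZero Λ}} → (∀ i → IsInteger (fromℕ Λ * w i)) → (∀ i → w i ≤ 1ℚ) →
                     ↧ₙ gain ℕ.≤ n ℕ.* Λ
  gain-denominator Λ scaled∈ℤ w≤1 = denominator-bound gain (L * mass) (n ℕ.* Λ) scaledMass∈ℤ gainScaled∈ℤ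
    (*-pos (fromℕ-pos Λ (ℕ.>-nonZero⁻¹ Λ)) mass>0) scaledMass≤nΛ
    where
    L = fromℕ Λ
    scaledMass∈ℤ : IsInteger (L * mass)
    scaledMass∈ℤ = subst IsInteger (sym (*-distribˡ-sum L w)) (isInteger-sum _ scaled∈ℤ)
    gainScaled∈ℤ : IsInteger (gain * (L * mass))
    gainScaled∈ℤ = subst IsInteger (sym (begin
      gain * (L * mass)                 ≡⟨ solve 4 (λ ρ u l m → ρ :* u :* (l :* m) := l :* ρ :* (m :* u)) refl reward (1/ mass) L mass ⟩
      L * reward * (mass * 1/ mass)     ≡⟨ cong (L * reward *_) (ℚₚ.*-inverseʳ mass) ⟩
      L * reward * 1ℚ                   ≡⟨ ℚₚ.*-identityʳ _ ⟩
      L * reward                        ≡⟨ *-distribˡ-sum L (λ i → w i * toℚ r i) ⟩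
      sum (λ i → L * (w i * toℚ r i))   ≡⟨ sum-cong-≗ (λ i → ℚₚ.*-assoc L (w i) (toℚ r i)) ⟨
      sum (λ i → L * w i * toℚ r i)     ∎))
      (isInteger-sum _ (λ i → isInteger-* (scaled∈ℤ i) (isInteger-/1 (r i))))
    scaledMass≤nΛ : L * mass ≤ fromℕ (n ℕ.* Λ)
    scaledMass≤nΛ = subst (L * mass ≤_) (trans (fromℕ-* Λ n) (cong fromℕ (ℕₚ.*-comm Λ n)))
      (ℚₚ.*-monoˡ-≤-nonNeg L {{ℚ.nonNegative (ℚₚ.<⇒≤ (fromℕ-pos Λ (ℕ.>-nonZero⁻¹ Λ)))}}
        (subst (mass ≤_) (sum-ones n) (sum-mono-≤ w (λ _ → 1ℚ) w≤1)))

module _ {A : Set} (f : A → A) where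

  iterate-+ : ∀ x a b → iterate f x (a ℕ.+ b) ≡ iterate f (iterate f x a) b
  iterate-+ x zero    b = refl
  iterate-+ x (suc a) b = iterate-+ (f x) a b

  iterate-sucʳ : ∀ x t → iterate f x (suc t) ≡ f (iterate f x t)
  iterate-sucʳ x zero    = refl
  iterate-sucʳ x (suc t) = iterate-sucʳ (f x) t

iterate-cong-along : ∀ {A : Set} (f g : A → A) x t →
                     (∀ s → s ℕ.< t → f (iterate f x s) ≡ g (iterate f x s)) → iterate f x t ≡ iterate g x t
iterate-cong-along f g x zero    _   = refl
iterate-cong-along f g x (suc t) f≗g = trans
  (iterate-cong-along f g (f x) t (λ s s<t → f≗g (suc s) (s≤s s<t)))
  (cong (λ y → iterate g y t) (f≗g 0 (s≤s z≤n)))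

module _ {n : ℕ} where

  Reaches : (Fin n → Fin n) → Fin n → Fin n → Set
  Reaches f j k = Σ[ t ∈ Fin (suc n) ] iterate f j (toℕ t) ≡ k

  reaches? : ∀ f j k → Dec (Reaches f j k)
  reaches? f j k = Finₚ.any? (λ t → iterate f j (toℕ t) Finₚ.≟ k)

  reaches-≤ : ∀ {f j k} t → t ℕ.≤ n → iterate f j t ≡ k → Reaches f j k
  reaches-≤ {f} {j} t t≤n hit = Fin.fromℕ< (s≤s t≤n) , trans (cong (iterate f j) (Finₚ.toℕ-fromℕ< (s≤s t≤n))) hit

  -- Pigeonhole on the first n + 1 points of the orbit.
  iterate-shortcut : ∀ f j t → n ℕ.< t → ∃[ t' ] (t' ℕ.< t × iterate f j t' ≡ iterate f j t)
  iterate-shortcut f j t n<t with Finₚ.pigeonhole (ℕₚ.n<1+n n) (λ s → iterate f j (toℕ s))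
  ... | a , b , a<b , same = toℕ a ℕ.+ (t ∸ toℕ b) , shorter , loop
    where
    b≤t : toℕ b ℕ.≤ t
    b≤t = ℕₚ.≤-trans (ℕₚ.<⇒≤pred (Finₚ.toℕ<n b)) (ℕₚ.<⇒≤ n<t)
    shorter : toℕ a ℕ.+ (t ∸ toℕ b) ℕ.< t
    shorter = subst (toℕ a ℕ.+ (t ∸ toℕ b) ℕ.<_) (ℕₚ.m+[n∸m]≡n b≤t) (ℕₚ.+-monoˡ-< (t ∸ toℕ b) a<b)
    loop : iterate f j (toℕ a ℕ.+ (t ∸ toℕ b)) ≡ iterate f j t
    loop = begin
      iterate f j (toℕ a ℕ.+ (t ∸ toℕ b))           ≡⟨ iterate-+ f j (toℕ a) (t ∸ toℕ b) ⟩
      iterate f (iterate f j (toℕ a)) (t ∸ toℕ b)   ≡⟨ cong (λ x → iterate f x (t ∸ toℕ b)) same ⟩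
      iterate f (iterate f j (toℕ b)) (t ∸ toℕ b)   ≡⟨ iterate-+ f j (toℕ b) (t ∸ toℕ b) ⟨
      iterate f j (toℕ b ℕ.+ (t ∸ toℕ b))           ≡⟨ cong (iterate f j) (ℕₚ.m+[n∸m]≡n b≤t) ⟩
      iterate f j t                                  ∎
      where open ≡-Reasoning

  iterate⇒reaches : ∀ {f j k} t → iterate f j t ≡ k → Reaches f j k
  iterate⇒reaches {f} {j} {k} = <-rec (λ t → iterate f j t ≡ k → Reaches f j k) step
    where
    step : ∀ t → (∀ {t'} → t' ℕ.< t → iterate f j t' ≡ k → Reaches f j k) → iterate f j t ≡ k → Reaches f j k
    step t rec hit with t ℕ.≤? n
    ... | yes t≤n = reaches-≤ t t≤n hit
    ... | no  t≰n with iterate-shortcut f j t (ℕₚ.≰⇒> t≰n)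
    ...   | t' , t'<t , same = rec t'<t (trans same hit)

  reaches-trans : ∀ {f j k l} → Reaches f j k → Reaches f k l → Reaches f j l
  reaches-trans {f} {j} (a , j→k) (b , k→l) =
    iterate⇒reaches (toℕ a ℕ.+ toℕ b) (trans (iterate-+ f j (toℕ a) (toℕ b)) (trans (cong (λ x → iterate f x (toℕ b)) j→k) k→l))

  reaches-cong : ∀ {f g j k} → (∀ x → f x ≡ g x) → Reaches f j k → Reaches g j k
  reaches-cong {f} {g} {j} f≗g (t , hit) = t , trans (sym (iterate-cong-along f g j (toℕ t) (λ s _ → f≗g _))) hit

  first-visit : ∀ (f : Fin n → Fin n) j t {i} → iterate f j t ≡ i →
                ∃[ t' ] (t' ℕ.≤ t × iterate f j t' ≡ i × (∀ s → s ℕ.< t' → iterate f j s ≢ i))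
  first-visit f j zero    hit = 0 , z≤n , hit , λ _ ()
  first-visit f j (suc t) {i} hit with j Finₚ.≟ i
  ... | yes j≡i = 0 , z≤n , j≡i , λ _ ()
  ... | no  j≢i with first-visit f (f j) t hit
  ...   | t' , t'≤t , hit' , before = suc t' , s≤s t'≤t , hit' , λ { zero _ → j≢i ; (suc s) (s≤s s<t') → before s s<t' }

  AllReach : Fin n → (Fin n → Fin n) → Set
  AllReach k f = ∀ j → Reaches f j k

  allReach? : ∀ k f → Dec (AllReach k f)
  allReach? k f = Finₚ.all? (λ j → reaches? f j k)

  IsArborescence : Fin n → (Fin n → Fin n) → Set
  IsArborescence i f = f i ≡ i × AllReach i f

  isArborescence? : ∀ i f → Dec (IsArborescence i f)
  isArborescence? i f = (f i Finₚ.≟ i) ×-dec allReach? i f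

  reaches-step : ∀ {f j k} → f j ≡ k → Reaches f j k
  reaches-step = iterate⇒reaches 1

  update-before-visit : ∀ (g : Vec (Fin n) n) i v j t → (∀ s → s ℕ.< t → iterate (lookup g) j s ≢ i) →
                        iterate (lookup g) j t ≡ iterate (lookup (g [ i ]≔ v)) j t
  update-before-visit g i v j t avoid =
    iterate-cong-along (lookup g) (lookup (g [ i ]≔ v)) j t
      (λ s s<t → sym (Vecₚ.lookup∘update′ (avoid s s<t) g v))

  allReach-update : ∀ (g : Vec (Fin n) n) i v → AllReach i (lookup g) → AllReach i (lookup (g [ i ]≔ v))
  allReach-update g i v reach j with first-visit (lookup g) j (toℕ (proj₁ (reach j))) (proj₂ (reach j))
  ... | t , _ , hit , avoid = iterate⇒reaches t (trans (sym (update-before-visit g i v j t avoid)) hit)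

  update-restore : ∀ (g : Vec (Fin n) n) i v → lookup g i ≡ i → (g [ i ]≔ v) [ i ]≔ i ≡ g
  update-restore g i v gi≡i =
    trans (Vecₚ.[]≔-idempotent g i) (trans (cong (g [ i ]≔_) (sym gi≡i)) (Vecₚ.[]≔-lookup g i))

  allReach-update⇒arborescence : ∀ (f : Vec (Fin n) n) i v → lookup f i ≡ i →
                                 AllReach i (lookup (f [ i ]≔ v)) → IsArborescence i (lookup f)
  allReach-update⇒arborescence f i v fi≡i reach =
    subst (λ g → IsArborescence i (lookup g)) (update-restore f i v fi≡i)
      (Vecₚ.lookup∘update i (f [ i ]≔ v) i , allReach-update (f [ i ]≔ v) i i reach)

  allReach-successor : ∀ {f i k} → f i ≡ k → AllReach i f → AllReach k f × Reaches f k i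
  allReach-successor {f} fi≡k reach = (λ j → reaches-trans (reach j) (reaches-step fi≡k)) , reach _

  allReach-predecessor : ∀ {f i k} → AllReach k f → Reaches f k i → AllReach i f
  allReach-predecessor reach k→i j = reaches-trans (reach j) k→i

  IsCyclePredecessor : (Fin n → Fin n) → Fin n → Fin n → Set
  IsCyclePredecessor f k i = f i ≡ k × Reaches f k i

  isCyclePredecessor? : ∀ f k i → Dec (IsCyclePredecessor f k i)
  isCyclePredecessor? f k i = (f i Finₚ.≟ k) ×-dec reaches? f k i

  cyclePredecessor-exists : ∀ f k → AllReach k f → ∃[ i ] IsCyclePredecessor f k i
  cyclePredecessor-exists f k reach with reach (f k)
  ... | t , hit = iterate f k (toℕ t) , trans (sym (iterate-sucʳ f k (toℕ t))) hit , t , refl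

  private
    earlier-return : ∀ (f : Fin n → Fin n) k {i'} a b → a ℕ.< b → f (iterate f k a) ≡ k →
                     iterate f k b ≡ i' → (∀ s → s ℕ.< b → iterate f k s ≢ i') → ⊥
    earlier-return f k {i'} a b a<b back hit first = first (b ∸ suc a) (ℕₚ.∸-monoʳ-< (s≤s z≤n) a<b) (begin
      iterate f k (b ∸ suc a)                       ≡⟨ cong (λ x → iterate f x (b ∸ suc a)) (trans (iterate-sucʳ f k a) back) ⟨
      iterate f (iterate f k (suc a)) (b ∸ suc a)   ≡⟨ iterate-+ f k (suc a) (b ∸ suc a) ⟨
      iterate f k (suc a ℕ.+ (b ∸ suc a))           ≡⟨ cong (iterate f k) (ℕₚ.m+[n∸m]≡n a<b) ⟩
      iterate f k b                                 ≡⟨ hit ⟩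
      i'                                            ∎)
      where open ≡-Reasoning

  cyclePredecessor-unique : ∀ f k {i i'} → IsCyclePredecessor f k i → IsCyclePredecessor f k i' → i ≡ i'
  cyclePredecessor-unique f k (fi≡k , t₁ , hit₁) (fi'≡k , t₂ , hit₂)
    with first-visit f k (toℕ t₁) hit₁ | first-visit f k (toℕ t₂) hit₂
  ... | a , _ , hit₁' , first₁ | b , _ , hit₂' , first₂ with ℕₚ.<-cmp a b
  ... | tri< a<b _ _ = ⊥-elim (earlier-return f k a b a<b (trans (cong f hit₁') fi≡k) hit₂' first₂)
  ... | tri≈ _ refl _ = trans (sym hit₁') hit₂'
  ... | tri> _ _ b<a = ⊥-elim (earlier-return f k b a b<a (trans (cong f hit₂') fi'≡k) hit₁' first₁)

module ArborescenceWeights {n : ℕ} (P : Matrix n) where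

  rootedAt : Fin n → Matrix n
  rootedAt i j l with j Finₚ.≟ i
  ... | yes _ = 𝟙 (l Finₚ.≟ i)
  ... | no  _ = P j l

  rootedAt-root : ∀ i l → rootedAt i i l ≡ 𝟙 (l Finₚ.≟ i)
  rootedAt-root i l with i Finₚ.≟ i
  ... | yes _   = refl
  ... | no  i≢i = ⊥-elim (i≢i refl)

  rootedAt-other : ∀ {i j} l → j ≢ i → rootedAt i j l ≡ P j l
  rootedAt-other {i} {j} l j≢i with j Finₚ.≟ i
  ... | yes j≡i = ⊥-elim (j≢i j≡i)
  ... | no  _   = refl

  mapWeight : Vec (Fin n) n → ℚ
  mapWeight g = prod (λ j → P j (lookup g j))

  treeWeight : Fin n → Vec (Fin n) n → ℚ
  treeWeight i f = prod (λ j → rootedAt i j (lookup f j))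

  arborescenceTerm : Fin n → Vec (Fin n) n → ℚ
  arborescenceTerm i f = 𝟙 (isArborescence? i (lookup f)) * treeWeight i f

  arborescenceWeight : Fin n → ℚ
  arborescenceWeight i = sumAll n (arborescenceTerm i)

  reachWeight : Fin n → ℚ
  reachWeight k = sumAll n (λ g → 𝟙 (allReach? k (lookup g)) * mapWeight g)

  treeWeight-update : ∀ i v f → lookup f i ≡ i → treeWeight i f * P i v ≡ mapWeight (f [ i ]≔ v)
  treeWeight-update i v f fi≡i = begin
    treeWeight i f * P i v                     ≡⟨ cong (λ x → treeWeight i f * P i x) (Vecₚ.lookup∘update i f v) ⟨
    prod before * after i                       ≡⟨ prod-exchange before after i unchanged ⟩
    mapWeight (f [ i ]≔ v) * before i           ≡⟨ cong (mapWeight (f [ i ]≔ v) *_) (trans (rootedAt-root i (lookup f i)) (𝟙-yes (lookup f i Finₚ.≟ i) fi≡i)) ⟩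
    mapWeight (f [ i ]≔ v) * 1ℚ                 ≡⟨ ℚₚ.*-identityʳ _ ⟩
    mapWeight (f [ i ]≔ v)                      ∎
    where
    open ≡-Reasoning
    before after : Fin n → ℚ
    before j = rootedAt i j (lookup f j)
    after  j = P j (lookup (f [ i ]≔ v) j)
    unchanged : ∀ j → j ≢ i → before j ≡ after j
    unchanged j j≢i = trans (rootedAt-other (lookup f j) j≢i) (cong (P j) (sym (Vecₚ.lookup∘update′ j≢i f v)))

  arborescenceTerm-update : ∀ i v f {q} {Q : Set q} (Q? : Dec Q) →
    (lookup f i ≡ i → IsArborescence i (lookup f) → Q) → (lookup f i ≡ i → Q → IsArborescence i (lookup f)) →
    arborescenceTerm i f * P i v ≡ 𝟙 (lookup f i Finₚ.≟ i) * (𝟙 Q? * mapWeight (f [ i ]≔ v))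
  arborescenceTerm-update i v f Q? to from = split (lookup f i Finₚ.≟ i)
    where
    open ≡-Reasoning
    split : (fi≟i : Dec (lookup f i ≡ i)) → arborescenceTerm i f * P i v ≡ 𝟙 fi≟i * (𝟙 Q? * mapWeight (f [ i ]≔ v))
    split (no fi≢i) = begin
      𝟙 (isArborescence? i (lookup f)) * treeWeight i f * P i v
        ≡⟨ cong (λ x → x * treeWeight i f * P i v) (𝟙-no (isArborescence? i (lookup f)) (fi≢i ∘ proj₁)) ⟩
      0ℚ * treeWeight i f * P i v
        ≡⟨ cong (_* P i v) (ℚₚ.*-zeroˡ (treeWeight i f)) ⟩
      0ℚ * P i v
        ≡⟨ ℚₚ.*-zeroˡ (P i v) ⟩
      0ℚ
        ≡⟨ ℚₚ.*-zeroˡ (𝟙 Q? * mapWeight (f [ i ]≔ v)) ⟨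
      0ℚ * (𝟙 Q? * mapWeight (f [ i ]≔ v)) ∎
    split (yes fi≡i) = begin
      𝟙 (isArborescence? i (lookup f)) * treeWeight i f * P i v
        ≡⟨ cong (λ x → x * treeWeight i f * P i v) (𝟙-cong (isArborescence? i (lookup f)) Q? (to fi≡i) (from fi≡i)) ⟩
      𝟙 Q? * treeWeight i f * P i v
        ≡⟨ ℚₚ.*-assoc (𝟙 Q?) _ _ ⟩
      𝟙 Q? * (treeWeight i f * P i v)
        ≡⟨ cong (𝟙 Q? *_) (treeWeight-update i v f fi≡i) ⟩
      𝟙 Q? * mapWeight (f [ i ]≔ v)
        ≡⟨ ℚₚ.*-identityˡ _ ⟨
      1ℚ * (𝟙 Q? * mapWeight (f [ i ]≔ v)) ∎

  sum-cyclePredecessor : ∀ (g : Vec (Fin n) n) k x →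
    sum (λ i → 𝟙 (lookup g i Finₚ.≟ k) * (𝟙 (allReach? k (lookup g) ×-dec reaches? (lookup g) k i) * x))
      ≡ 𝟙 (allReach? k (lookup g)) * x
  sum-cyclePredecessor g k x = begin
    sum (λ i → 𝟙 (lookup g i Finₚ.≟ k) * (𝟙 (AR? ×-dec R? i) * x))
      ≡⟨ sum-cong-≗ regroup ⟩
    sum (λ i → 𝟙 (isCyclePredecessor? (lookup g) k i) * (𝟙 AR? * x))
      ≡⟨ *-distribʳ-sum (𝟙 AR? * x) (λ i → 𝟙 (isCyclePredecessor? (lookup g) k i)) ⟨
    sum (λ i → 𝟙 (isCyclePredecessor? (lookup g) k i)) * (𝟙 AR? * x)
      ≡⟨ count AR? ⟩
    𝟙 AR? * x ∎
    where
    open ≡-Reasoning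
    AR? = allReach? k (lookup g)
    R? = reaches? (lookup g) k
    regroup : ∀ i → 𝟙 (lookup g i Finₚ.≟ k) * (𝟙 (AR? ×-dec R? i) * x) ≡ 𝟙 (isCyclePredecessor? (lookup g) k i) * (𝟙 AR? * x)
    regroup i = begin
      𝟙 (lookup g i Finₚ.≟ k) * (𝟙 (AR? ×-dec R? i) * x)
        ≡⟨ cong (λ y → 𝟙 (lookup g i Finₚ.≟ k) * (y * x)) (𝟙-×-dec AR? (R? i)) ⟩
      𝟙 (lookup g i Finₚ.≟ k) * (𝟙 AR? * 𝟙 (R? i) * x)
        ≡⟨ solve 4 (λ a b c y → a :* (b :* c :* y) := a :* c :* (b :* y)) refl (𝟙 (lookup g i Finₚ.≟ k)) (𝟙 AR?) (𝟙 (R? i)) x ⟩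
      𝟙 (lookup g i Finₚ.≟ k) * 𝟙 (R? i) * (𝟙 AR? * x)
        ≡⟨ cong (_* (𝟙 AR? * x)) (𝟙-×-dec (lookup g i Finₚ.≟ k) (R? i)) ⟨
      𝟙 (isCyclePredecessor? (lookup g) k i) * (𝟙 AR? * x) ∎
    count : (d : Dec (AllReach k (lookup g))) →
            sum (λ i → 𝟙 (isCyclePredecessor? (lookup g) k i)) * (𝟙 d * x) ≡ 𝟙 d * x
    count (no _) = trans (cong (sum (λ i → 𝟙 (isCyclePredecessor? (lookup g) k i)) *_) (ℚₚ.*-zeroˡ x))
                         (trans (ℚₚ.*-zeroʳ (sum (λ i → 𝟙 (isCyclePredecessor? (lookup g) k i)))) (sym (ℚₚ.*-zeroˡ x)))
    count (yes reach) with cyclePredecessor-exists (lookup g) k reach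
    ... | i₀ , pred = trans (cong (_* (1ℚ * x))
                               (sum-𝟙-unique (isCyclePredecessor? (lookup g) k) i₀ pred
                                 (λ i predᵢ → cyclePredecessor-unique (lookup g) k predᵢ pred)))
                             (ℚₚ.*-identityˡ _)

  inflow≡reachWeight : ∀ k → sum (λ i → arborescenceWeight i * P i k) ≡ reachWeight k
  inflow≡reachWeight k = begin
    sum (λ i → arborescenceWeight i * P i k)
      ≡⟨ sum-cong-≗ (λ i → *-distribʳ-sumAll n (P i k) (arborescenceTerm i)) ⟩
    sum (λ i → sumAll n (λ f → arborescenceTerm i f * P i k))
      ≡⟨ sum-cong-≗ (λ i → sumAll-cong n (λ f → arborescenceTerm-update i k f (Q? i (f [ i ]≔ k)) (to i f) (from i f))) ⟩
    sum (λ i → sumAll n (λ f → 𝟙 (lookup f i Finₚ.≟ i) * F i (f [ i ]≔ k)))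
      ≡⟨ sum-cong-≗ (λ i → sumAll-update n i k i (F i)) ⟨
    sum (λ i → sumAll n (λ g → 𝟙 (lookup g i Finₚ.≟ k) * F i g))
      ≡⟨ sumAll-sum-comm n (λ i g → 𝟙 (lookup g i Finₚ.≟ k) * F i g) ⟨
    sumAll n (λ g → sum (λ i → 𝟙 (lookup g i Finₚ.≟ k) * F i g))
      ≡⟨ sumAll-cong n (λ g → sum-cyclePredecessor g k (mapWeight g)) ⟩
    reachWeight k ∎
    where
    open ≡-Reasoning
    Q? : ∀ i g → Dec (AllReach k (lookup g) × Reaches (lookup g) k i)
    Q? i g = allReach? k (lookup g) ×-dec reaches? (lookup g) k i
    F : Fin n → Vec (Fin n) n → ℚ
    F i g = 𝟙 (Q? i g) * mapWeight g
    to : ∀ i f → lookup f i ≡ i → IsArborescence i (lookup f) →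
         AllReach k (lookup (f [ i ]≔ k)) × Reaches (lookup (f [ i ]≔ k)) k i
    to i f _ arb = allReach-successor (Vecₚ.lookup∘update i f k) (allReach-update f i k (proj₂ arb))
    from : ∀ i f → lookup f i ≡ i → AllReach k (lookup (f [ i ]≔ k)) × Reaches (lookup (f [ i ]≔ k)) k i →
           IsArborescence i (lookup f)
    from i f fi≡i (reach , k→i) = allReach-update⇒arborescence f i k fi≡i (allReach-predecessor reach k→i)

  arborescenceWeight≡reachWeight : (∀ i → sum (P i) ≡ 1ℚ) → ∀ k → arborescenceWeight k ≡ reachWeight k
  arborescenceWeight≡reachWeight rowSum k = begin
    arborescenceWeight k
      ≡⟨ ℚₚ.*-identityʳ _ ⟨
    arborescenceWeight k * 1ℚ
      ≡⟨ cong (arborescenceWeight k *_) (rowSum k) ⟨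
    arborescenceWeight k * sum (P k)
      ≡⟨ *-distribˡ-sum (arborescenceWeight k) (P k) ⟩
    sum (λ l → arborescenceWeight k * P k l)
      ≡⟨ sum-cong-≗ (λ l → *-distribʳ-sumAll n (P k l) (arborescenceTerm k)) ⟩
    sum (λ l → sumAll n (λ f → arborescenceTerm k f * P k l))
      ≡⟨ sum-cong-≗ (λ l → sumAll-cong n (λ f → arborescenceTerm-update k l f (allReach? k (lookup (f [ k ]≔ l)))
                                                   (λ _ arb → allReach-update f k l (proj₂ arb))
                                                   (allReach-update⇒arborescence f k l))) ⟩
    sum (λ l → sumAll n (λ f → 𝟙 (lookup f k Finₚ.≟ k) * G (f [ k ]≔ l)))
      ≡⟨ sum-cong-≗ (λ l → sumAll-update n k l k G) ⟨
    sum (λ l → sumAll n (λ g → 𝟙 (lookup g k Finₚ.≟ l) * G g))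
      ≡⟨ sumAll-sum-comm n (λ l g → 𝟙 (lookup g k Finₚ.≟ l) * G g) ⟨
    sumAll n (λ g → sum (λ l → 𝟙 (lookup g k Finₚ.≟ l) * G g))
      ≡⟨ sumAll-cong n (λ g → trans (sym (*-distribʳ-sum (G g) (λ l → 𝟙 (lookup g k Finₚ.≟ l))))
                                 (trans (cong (_* G g) (sum-𝟙-unique (lookup g k Finₚ.≟_) (lookup g k) refl (λ _ → sym)))
                                        (ℚₚ.*-identityˡ (G g)))) ⟩
    reachWeight k ∎
    where
    open ≡-Reasoning
    G : Vec (Fin n) n → ℚ
    G g = 𝟙 (allReach? k (lookup g)) * mapWeight g

  arborescenceWeight-invariant : (∀ i → sum (P i) ≡ 1ℚ) →
                                 ∀ k → sum (λ i → arborescenceWeight i * P i k) ≡ arborescenceWeight k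
  arborescenceWeight-invariant rowSum k = trans (inflow≡reachWeight k) (sym (arborescenceWeight≡reachWeight rowSum k))

  module _ (P≥0 : ∀ i j → 0ℚ ≤ P i j) where

    rootedAt-nonNeg : ∀ i j l → 0ℚ ≤ rootedAt i j l
    rootedAt-nonNeg i j l with j Finₚ.≟ i
    ... | yes _ = 0≤𝟙 (l Finₚ.≟ i)
    ... | no  _ = P≥0 j l

    treeWeight-nonNeg : ∀ i f → 0ℚ ≤ treeWeight i f
    treeWeight-nonNeg i f = prod-nonNeg _ (λ j → rootedAt-nonNeg i j (lookup f j))

    arborescenceTerm-nonNeg : ∀ i f → 0ℚ ≤ arborescenceTerm i f
    arborescenceTerm-nonNeg i f = *-nonNeg (0≤𝟙 (isArborescence? i (lookup f))) (treeWeight-nonNeg i f)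

    arborescenceWeight-nonNeg : ∀ i → 0ℚ ≤ arborescenceWeight i
    arborescenceWeight-nonNeg i = sumAll-nonNeg n _ (arborescenceTerm-nonNeg i)

    treeWeight≤arborescenceWeight : ∀ i f → IsArborescence i (lookup f) → treeWeight i f ≤ arborescenceWeight i
    treeWeight≤arborescenceWeight i f arb =
      subst (_≤ arborescenceWeight i) (trans (cong (_* treeWeight i f) (𝟙-yes (isArborescence? i (lookup f)) arb)) (ℚₚ.*-identityˡ _))
        (term≤sumAll n (arborescenceTerm i) (arborescenceTerm-nonNeg i) f)

    -- The tree weights over all maps f sum to ∏ⱼ ∑ₗ rootedAt i j l = 1.
    arborescenceWeight≤1 : (∀ i → sum (P i) ≡ 1ℚ) → ∀ i → arborescenceWeight i ≤ 1ℚ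
    arborescenceWeight≤1 rowSum i = ℚₚ.≤-trans (sumAll-mono-≤ n _ _ term≤treeWeight) (ℚₚ.≤-reflexive allTrees≡1)
      where
      term≤treeWeight : ∀ f → arborescenceTerm i f ≤ treeWeight i f
      term≤treeWeight f = subst (arborescenceTerm i f ≤_) (ℚₚ.*-identityˡ (treeWeight i f))
        (ℚₚ.*-monoʳ-≤-nonNeg (treeWeight i f) {{ℚ.nonNegative (treeWeight-nonNeg i f)}} (𝟙≤1 (isArborescence? i (lookup f))))
      rootedAt-rowSum : ∀ j → sum (rootedAt i j) ≡ 1ℚ
      rootedAt-rowSum j with j Finₚ.≟ i
      ... | yes _ = sum-𝟙-unique (Finₚ._≟ i) i refl (λ _ → id)
      ... | no  _ = rowSum j
      allTrees≡1 : sumAll n (treeWeight i) ≡ 1ℚ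
      allTrees≡1 = trans (sumAll-prod n (rootedAt i)) (trans (prod-cong rootedAt-rowSum) (prod-replicate-one n))

  -- Row i does not enter the weights of arborescences rooted at i.
  arborescenceWeight-isInteger : ∀ (m : Fin n → ℕ) i → (∀ j l → j ≢ i → IsInteger (fromℕ (m j) * P j l)) →
                                 IsInteger (fromℕ (prodFin m) * arborescenceWeight i)
  arborescenceWeight-isInteger m i scaledRow∈ℤ =
    subst IsInteger (sym scaled) (isInteger-sumAll n _ (λ f → isInteger-* (isInteger-𝟙 (isArborescence? i (lookup f)))
      (subst IsInteger (prod-distrib-* (λ j → fromℕ (m j)) (λ j → rootedAt i j (lookup f j)))
        (isInteger-prod _ (λ j → scaledFactor∈ℤ j (lookup f j))))))
    where
    c = prod (λ j → fromℕ (m j))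
    scaled : fromℕ (prodFin m) * arborescenceWeight i ≡ sumAll n (λ f → 𝟙 (isArborescence? i (lookup f)) * (c * treeWeight i f))
    scaled = trans (cong (_* arborescenceWeight i) (fromℕ-prod m))
      (trans (*-distribˡ-sumAll n c (arborescenceTerm i))
        (sumAll-cong n (λ f → solve 3 (λ c a w → c :* (a :* w) := a :* (c :* w)) refl c (𝟙 (isArborescence? i (lookup f))) (treeWeight i f))))
    scaledFactor∈ℤ : ∀ j l → IsInteger (fromℕ (m j) * rootedAt i j l)
    scaledFactor∈ℤ j l with j Finₚ.≟ i
    ... | yes _   = isInteger-* (isInteger-/1 (+ m j)) (isInteger-𝟙 (l Finₚ.≟ i))
    ... | no  j≢i = scaledRow∈ℤ j l j≢i

does-true⇒ : ∀ {p} {P : Set p} (P? : Dec P) → does P? ≡ true → P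
does-true⇒ (yes p) _ = p

module _ {n : ℕ} where

  ∈-tabulate⁺ : ∀ {p} {P : Fin n → Set p} (P? : ∀ x → Dec (P x)) {x} → P x → x ∈ tabulate (λ y → does (P? y))
  ∈-tabulate⁺ P? {x} px = Vecₚ.lookup⇒[]= x _ (trans (Vecₚ.lookup∘tabulate _ x) (dec-true (P? x) px))

  ∈-tabulate⁻ : ∀ {p} {P : Fin n → Set p} (P? : ∀ x → Dec (P x)) {x} → x ∈ tabulate (λ y → does (P? y)) → P x
  ∈-tabulate⁻ P? {x} x∈ = does-true⇒ (P? x) (trans (sym (Vecₚ.lookup∘tabulate _ x)) (Vecₚ.[]=⇒lookup x∈))

  ⊈⇒witness : ∀ {p q : Subset n} → ¬ (p ⊆ q) → ∃[ x ] (x ∈ p × x ∉ q)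
  ⊈⇒witness {p} {q} p⊈q with Finₚ.¬∀⟶∃¬ n _ (λ x → x ∈? p →-dec x ∈? q) (λ p⊆q → p⊈q (λ {x} → p⊆q x))
  ... | x , x∈p⇏x∈q with x ∈? p
  ...   | yes x∈p = x , x∈p , λ x∈q → x∈p⇏x∈q (λ _ → x∈q)
  ...   | no  x∉p = ⊥-elim (x∈p⇏x∈q (⊥-elim ∘ x∉p))

  orbit-exit : ∀ (S : Subset n) f {x} t → x ∈ S → iterate f x t ∉ S → ∃[ y ] (y ∈ S × f y ∉ S)
  orbit-exit S f zero    x∈S x∉S = ⊥-elim (x∉S x∈S)
  orbit-exit S f {x} (suc t) x∈S end∉S with f x ∈? S
  ... | yes fx∈S = orbit-exit S f t fx∈S end∉S
  ... | no  fx∉S = x , x∈S , fx∉S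

module BackwardSearch {n : ℕ} {E : Fin n → Fin n → Set} (E? : ∀ j l → Dec (E j l)) (c : Fin n) where

  predecessors : Subset n → Subset n
  predecessors X = tabulate (λ j → does (Finₚ.any? (λ l → E? j l ×-dec l ∈? X)))

  layer : ℕ → Subset n
  layer zero    = ⁅ c ⁆
  layer (suc t) = layer t ∪ predecessors (layer t)

  -- next t j is the first step of a path of length at most t from j to c.
  next : ℕ → Fin n → Fin n
  next zero    j = c
  next (suc t) j with j ∈? layer t | Finₚ.any? (λ l → E? j l ×-dec l ∈? layer t)
  ... | yes _ | _            = next t j
  ... | no  _ | yes (l , _)  = l
  ... | no  _ | no  _        = c

  c∈layer : ∀ t → c ∈ layer t
  c∈layer zero    = x∈⁅x⁆ c
  c∈layer (suc t) = p⊆p∪q _ (c∈layer t)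

  next-stable : ∀ t {j} → j ∈ layer t → next (suc t) j ≡ next t j
  next-stable t {j} j∈L with j ∈? layer t
  ... | yes _   = refl
  ... | no  j∉L = ⊥-elim (j∉L j∈L)

  next-new : ∀ t {j} → j ∈ layer (suc t) → j ∉ layer t → E j (next (suc t) j) × next (suc t) j ∈ layer t
  next-new t {j} j∈L' j∉L with j ∈? layer t | Finₚ.any? (λ l → E? j l ×-dec l ∈? layer t)
  ... | yes j∈L | _                     = ⊥-elim (j∉L j∈L)
  ... | no  _   | yes (l , edge , l∈L)  = edge , l∈L
  ... | no  _   | no  noEdge with x∈p∪q⁻ (layer t) _ j∈L'
  ...   | inj₁ j∈L  = ⊥-elim (j∉L j∈L)
  ...   | inj₂ j∈pred = ⊥-elim (noEdge (∈-tabulate⁻ (λ y → Finₚ.any? (λ l → E? y l ×-dec l ∈? layer t)) j∈pred))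

  next-root : ∀ t → next t c ≡ c
  next-root zero    = refl
  next-root (suc t) = trans (next-stable t (c∈layer t)) (next-root t)

  next-step : ∀ t {j} → j ∈ layer (suc t) → j ∈ layer t ⊎ (E j (next (suc t) j) × next (suc t) j ∈ layer t)
  next-step t {j} j∈L' = split (j ∈? layer t)
    where
    split : Dec (j ∈ layer t) → j ∈ layer t ⊎ (E j (next (suc t) j) × next (suc t) j ∈ layer t)
    split (yes j∈L) = inj₁ j∈L
    split (no  j∉L) = inj₂ (next-new t j∈L' j∉L)

  next-within : ∀ t {j} → j ∈ layer t → next t j ∈ layer t
  next-within zero    j∈L = c∈layer zero
  next-within (suc t) j∈L' with next-step t j∈L'
  ... | inj₁ j∈L         = subst (_∈ layer (suc t)) (sym (next-stable t j∈L)) (p⊆p∪q _ (next-within t j∈L))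
  ... | inj₂ (_ , l∈L)   = p⊆p∪q _ l∈L

  next-edge : ∀ t {j} → j ∈ layer t → j ≢ c → E j (next t j)
  next-edge zero    j∈L j≢c = ⊥-elim (j≢c (x∈⁅y⁆⇒x≡y c j∈L))
  next-edge (suc t) {j} j∈L' j≢c with next-step t j∈L'
  ... | inj₁ j∈L        = subst (E j) (sym (next-stable t j∈L)) (next-edge t j∈L j≢c)
  ... | inj₂ (edge , _) = edge

  next-orbit-within : ∀ t {j} → j ∈ layer t → ∀ s → iterate (next t) j s ∈ layer t
  next-orbit-within t j∈L zero    = j∈L
  next-orbit-within t j∈L (suc s) = next-orbit-within t (next-within t j∈L) s

  next-orbit-stable : ∀ t {j} → j ∈ layer t → ∀ s → iterate (next t) j s ≡ iterate (next (suc t)) j s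
  next-orbit-stable t {j} j∈L s =
    iterate-cong-along (next t) (next (suc t)) j s (λ r _ → sym (next-stable t (next-orbit-within t j∈L r)))

  next-reaches : ∀ t {j} → j ∈ layer t → iterate (next t) j t ≡ c
  next-reaches zero    j∈L = x∈⁅y⁆⇒x≡y c j∈L
  next-reaches (suc t) {j} j∈L' with next-step t j∈L'
  ... | inj₁ j∈L = begin
    iterate (next (suc t)) j (suc t)          ≡⟨ iterate-sucʳ (next (suc t)) j t ⟩
    next (suc t) (iterate (next (suc t)) j t) ≡⟨ cong (next (suc t)) (next-orbit-stable t j∈L t) ⟨
    next (suc t) (iterate (next t) j t)       ≡⟨ cong (next (suc t)) (next-reaches t j∈L) ⟩
    next (suc t) c                            ≡⟨ next-root (suc t) ⟩
    c                                         ∎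
    where open ≡-Reasoning
  ... | inj₂ (_ , l∈L) = begin
    iterate (next (suc t)) (next (suc t) j) t ≡⟨ next-orbit-stable t l∈L t ⟨
    iterate (next t) (next (suc t) j) t       ≡⟨ next-reaches t l∈L ⟩
    c                                         ∎
    where open ≡-Reasoning

  -- While the layers keep growing, layer t has more than t elements; so they stop growing before t = n.
  layers-stabilise-or-grow : ∀ t → (∃[ s ] layer (suc s) ⊆ layer s) ⊎ t ℕ.< Subset.∣ layer t ∣
  layers-stabilise-or-grow zero = inj₂ (subst (0 ℕ.<_) (sym (∣⁅x⁆∣≡1 c)) (s≤s z≤n))
  layers-stabilise-or-grow (suc t) with layers-stabilise-or-grow t
  ... | inj₁ stable = inj₁ stable
  ... | inj₂ t<∣L∣ with layer (suc t) ⊆? layer t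
  ...   | yes L'⊆L = inj₁ (t , L'⊆L)
  ...   | no  L'⊈L = inj₂ (ℕₚ.≤-trans (s≤s t<∣L∣) (p⊂q⇒∣p∣<∣q∣ (p⊆p∪q _ , ⊈⇒witness L'⊈L)))

  stable-layer : ∃[ t ] layer (suc t) ⊆ layer t
  stable-layer with layers-stabilise-or-grow n
  ... | inj₁ stable = stable
  ... | inj₂ n<∣L∣  = ⊥-elim (ℕₚ.<⇒≱ n<∣L∣ (∣p∣≤n (layer n)))

  depth : ℕ
  depth = proj₁ stable-layer

  reached : Subset n
  reached = layer depth

  toRoot : Fin n → Fin n
  toRoot = next depth

  c∈reached : c ∈ reached
  c∈reached = c∈layer depth

  reached-backward-closed : ∀ {j l} → l ∈ reached → E j l → j ∈ reached
  reached-backward-closed l∈R edge = proj₂ stable-layer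
    (q⊆p∪q _ _ (∈-tabulate⁺ (λ y → Finₚ.any? (λ z → E? y z ×-dec z ∈? reached)) (_ , edge , l∈R)))

  toRoot-root : toRoot c ≡ c
  toRoot-root = next-root depth

  toRoot-edge : ∀ {j} → j ∈ reached → j ≢ c → E j (toRoot j)
  toRoot-edge = next-edge depth

  toRoot-reaches : ∀ {j} → j ∈ reached → Reaches toRoot j c
  toRoot-reaches j∈R = iterate⇒reaches depth (next-reaches depth j∈R)

∣-lcmFin : ∀ {n} (f : Fin n → ℕ) j → f j ∣ lcmFin f
∣-lcmFin {suc n} f zero    = m∣lcm[m,n] (f zero) _
∣-lcmFin {suc n} f (suc j) = ∣-trans (∣-lcmFin (λ i → f (suc i)) j) (n∣lcm[m,n] (f zero) _)

lcm-nonZero : ∀ m n .{{_ : ℕ.NonZero m}} .{{_ : ℕ.NonZero n}} → ℕ.NonZero (lcm m n)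
lcm-nonZero m n = ℕₚ.m*n≢0⇒n≢0 (gcd m n) {{subst ℕ.NonZero (sym (gcd*lcm m n)) (ℕₚ.m*n≢0 m n)}}

lcmFin-nonZero : ∀ {n} (f : Fin n → ℕ) → (∀ j → ℕ.NonZero (f j)) → ℕ.NonZero (lcmFin f)
lcmFin-nonZero {zero}  f _     = _
lcmFin-nonZero {suc n} f f≢0 =
  lcm-nonZero (f zero) (lcmFin (λ i → f (suc i))) {{f≢0 zero}} {{lcmFin-nonZero (λ i → f (suc i)) (λ i → f≢0 (suc i))}}

prodFin-nonZero : ∀ {n} (f : Fin n → ℕ) → (∀ j → ℕ.NonZero (f j)) → ℕ.NonZero (prodFin f)
prodFin-nonZero {zero}  f _   = _
prodFin-nonZero {suc n} f f≢0 =
  ℕₚ.m*n≢0 (f zero) (prodFin (λ i → f (suc i))) {{f≢0 zero}} {{prodFin-nonZero (λ i → f (suc i)) (λ i → f≢0 (suc i))}}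

prodFin-const : ∀ n m → prodFin {n} (λ _ → m) ≡ m ^ n
prodFin-const zero    m = refl
prodFin-const (suc n) m = cong (m ℕ.*_) (prodFin-const n m)

except : ∀ {n} → Fin n → ℕ → Fin n → ℕ
except i m j = if does (j Finₚ.≟ i) then 1 else m

prodFin-except : ∀ {n} (i : Fin n) m → prodFin (except i m) ≡ m ^ (n ∸ 1)
prodFin-except {suc n}       zero    m = trans (ℕₚ.+-identityʳ _) (prodFin-const n m)
prodFin-except {suc (suc n)} (suc i) m = cong (m ℕ.*_) (prodFin-except i m)

except-other : ∀ {n} {i j : Fin n} m → j ≢ i → except i m j ≡ m
except-other {i = i} {j} m j≢i = cong (if_then 1 else m) (dec-false (j Finₚ.≟ i) j≢i)

rowDen-nonZero : ∀ {n} (P : Matrix n) i → ℕ.NonZero (rowDen P i)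
rowDen-nonZero P i = lcmFin-nonZero (λ j → ↧ₙ P i j) (λ _ → _)

↧ₙ∣rowDen : ∀ {n} (P : Matrix n) i j → ↧ₙ P i j ∣ rowDen P i
↧ₙ∣rowDen P i = ∣-lcmFin (λ j → ↧ₙ P i j)

↧ₙ∣allDen : ∀ {n} (P : Matrix n) i j → ↧ₙ P i j ∣ allDen P
↧ₙ∣allDen P i j = ∣-trans (↧ₙ∣rowDen P i j) (∣-lcmFin (rowDen P) i)

module _ {n : ℕ} (P : Matrix n) where

  Closed : Subset n → Set
  Closed S = ∀ {j l} → j ∈ S → 0ℚ < P j l → l ∈ S

  record AccessibleClosedSet : Set where
    field
      members        : Subset n
      root           : Fin n
      toRoot         : Fin n → Fin n
      root∈members   : root ∈ members
      closed         : Closed members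
      toRoot-root    : toRoot root ≡ root
      toRoot-edge    : ∀ {j} → j ∈ members → j ≢ root → 0ℚ < P j (toRoot j)
      toRoot-reaches : ∀ {j} → j ∈ members → Reaches toRoot j root

  private
    module Search = BackwardSearch (λ j l → 0ℚ ℚ.<? P j l)

  -- If some state of S cannot reach x, the states of S that cannot reach x form a smaller closed set.
  accessibleClosedSet : ∀ S {x} → x ∈ S → Closed S → AccessibleClosedSet
  accessibleClosedSet S = <-rec Goal step Subset.∣ S ∣ S refl
    where
    Goal : ℕ → Set
    Goal m = ∀ S → Subset.∣ S ∣ ≡ m → ∀ {x} → x ∈ S → Closed S → AccessibleClosedSet
    step : ∀ m → (∀ {m'} → m' ℕ.< m → Goal m') → Goal m
    step _ rec S refl {x} x∈S closed-S with S ⊆? Search.reached x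
    ... | yes S⊆R = record
      { members        = S
      ; root           = x
      ; toRoot         = Search.toRoot x
      ; root∈members   = x∈S
      ; closed         = closed-S
      ; toRoot-root    = Search.toRoot-root x
      ; toRoot-edge    = λ j∈S → Search.toRoot-edge x (S⊆R j∈S)
      ; toRoot-reaches = λ j∈S → Search.toRoot-reaches x (S⊆R j∈S)
      }
    ... | no S⊈R with ⊈⇒witness S⊈R
    ...   | y , y∈S , y∉R = rec smaller (S ∩ ∁ R) refl (x∈p∩q⁺ (y∈S , x∉p⇒x∈∁p y∉R)) closed-S∖R
      where
      R = Search.reached x
      smaller : Subset.∣ S ∩ ∁ R ∣ ℕ.< Subset.∣ S ∣
      smaller = p⊂q⇒∣p∣<∣q∣ (p∩q⊆p S (∁ R) , x , x∈S ,
                             λ x∈S∖R → x∈∁p⇒x∉p (proj₂ (x∈p∩q⁻ S (∁ R) x∈S∖R)) (Search.c∈reached x))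
      closed-S∖R : Closed (S ∩ ∁ R)
      closed-S∖R {j} j∈S∖R edge with x∈p∩q⁻ S (∁ R) j∈S∖R
      ... | j∈S , j∈∁R = x∈p∩q⁺ (closed-S j∈S edge ,
                                  x∉p⇒x∈∁p (λ l∈R → x∈∁p⇒x∉p j∈∁R (Search.reached-backward-closed x l∈R edge)))

  module Collapse (P≥0 : ∀ i j → 0ℚ ≤ P i j) (rowSum : ∀ i → sum (P i) ≡ 1ℚ) (A : AccessibleClosedSet) where
    open AccessibleClosedSet A

    -- Now every state reaches the root, while the rows that carry weight are still those of P.
    Q : Matrix n
    Q j l with j ∈? members
    ... | yes _ = P j l
    ... | no  _ = 𝟙 (l Finₚ.≟ root)

    Q-inside : ∀ {j} l → j ∈ members → Q j l ≡ P j l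
    Q-inside {j} l j∈S with j ∈? members
    ... | yes _   = refl
    ... | no  j∉S = ⊥-elim (j∉S j∈S)

    Q-nonNeg : ∀ j l → 0ℚ ≤ Q j l
    Q-nonNeg j l with j ∈? members
    ... | yes _ = P≥0 j l
    ... | no  _ = 0≤𝟙 (l Finₚ.≟ root)

    Q-rowSum : ∀ j → sum (Q j) ≡ 1ℚ
    Q-rowSum j with j ∈? members
    ... | yes _ = rowSum j
    ... | no  _ = sum-𝟙-unique (Finₚ._≟ root) root refl (λ _ → id)

    Q-scaledRow-isInteger : ∀ m j → (∀ l → IsInteger (fromℕ m * P j l)) → ∀ l → IsInteger (fromℕ m * Q j l)
    Q-scaledRow-isInteger m j scaled∈ℤ l with j ∈? members
    ... | yes _ = scaled∈ℤ l
    ... | no  _ = isInteger-* (isInteger-/1 (+ m)) (isInteger-𝟙 (l Finₚ.≟ root))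

    open ArborescenceWeights Q public

    -- The root reaches i along the arborescence, so the path leaves the closed set by an edge of weight zero.
    arborescenceWeight-outside : ∀ {i} → i ∉ members → arborescenceWeight i ≡ 0ℚ
    arborescenceWeight-outside {i} i∉S = trans (sumAll-cong n (λ f → term≡0 f (isArborescence? i (lookup f)))) (sumAll-zero n)
      where
      term≡0 : ∀ f (arb? : Dec (IsArborescence i (lookup f))) → 𝟙 arb? * treeWeight i f ≡ 0ℚ
      term≡0 f (no _) = ℚₚ.*-zeroˡ (treeWeight i f)
      term≡0 f (yes (_ , reach)) with reach root
      ... | t , hit with orbit-exit members (lookup f) (toℕ t) root∈members (λ end∈S → i∉S (subst (_∈ members) hit end∈S))
      ...   | y , y∈S , fy∉S = trans (ℚₚ.*-identityˡ _) (prod-zero _ y exit≡0)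
        where
        exit≡0 : rootedAt i y (lookup f y) ≡ 0ℚ
        exit≡0 = begin
          rootedAt i y (lookup f y) ≡⟨ rootedAt-other {i} {y} (lookup f y) (λ { refl → i∉S y∈S }) ⟩
          Q y (lookup f y)          ≡⟨ Q-inside (lookup f y) y∈S ⟩
          P y (lookup f y)          ≡⟨ ℚₚ.≤-antisym (ℚₚ.≮⇒≥ (fy∉S ∘ closed y∈S)) (P≥0 y (lookup f y)) ⟩
          0ℚ                        ∎
          where open ≡-Reasoning

    arborescenceWeight-P-invariant : ∀ k → sum (λ i → arborescenceWeight i * P i k) ≡ arborescenceWeight k
    arborescenceWeight-P-invariant k = trans (sum-cong-≗ sameRow) (arborescenceWeight-invariant Q-rowSum k)
      where
      sameRow : ∀ i → arborescenceWeight i * P i k ≡ arborescenceWeight i * Q i k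
      sameRow i = split (i ∈? members)
        where
        split : Dec (i ∈ members) → arborescenceWeight i * P i k ≡ arborescenceWeight i * Q i k
        split (yes i∈S) = cong (arborescenceWeight i *_) (sym (Q-inside k i∈S))
        split (no  i∉S) = begin
          arborescenceWeight i * P i k ≡⟨ cong (_* P i k) (arborescenceWeight-outside i∉S) ⟩
          0ℚ * P i k                   ≡⟨ ℚₚ.*-zeroˡ (P i k) ⟩
          0ℚ                           ≡⟨ ℚₚ.*-zeroˡ (Q i k) ⟨
          0ℚ * Q i k                   ≡⟨ cong (_* Q i k) (arborescenceWeight-outside i∉S) ⟨
          arborescenceWeight i * Q i k ∎
          where open ≡-Reasoning

    spanningTree : Fin n → Fin n
    spanningTree j with j ∈? members
    ... | yes _ = toRoot j
    ... | no  _ = root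

    spanningTree-inside : ∀ {j} → j ∈ members → spanningTree j ≡ toRoot j
    spanningTree-inside {j} j∈S with j ∈? members
    ... | yes _   = refl
    ... | no  j∉S = ⊥-elim (j∉S j∈S)

    spanningTree-outside : ∀ {j} → j ∉ members → spanningTree j ≡ root
    spanningTree-outside {j} j∉S with j ∈? members
    ... | yes j∈S = ⊥-elim (j∉S j∈S)
    ... | no  _   = refl

    toRoot-within : ∀ {j} → j ∈ members → toRoot j ∈ members
    toRoot-within {j} j∈S with j Finₚ.≟ root
    ... | yes refl = subst (_∈ members) (sym toRoot-root) root∈members
    ... | no  j≢r  = closed j∈S (toRoot-edge j∈S j≢r)

    spanningTree-arborescence : IsArborescence root spanningTree
    spanningTree-arborescence = trans (spanningTree-inside root∈members) toRoot-root , reach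
      where
      orbit-within : ∀ {j} → j ∈ members → ∀ s → iterate toRoot j s ∈ members
      orbit-within j∈S zero    = j∈S
      orbit-within j∈S (suc s) = orbit-within (toRoot-within j∈S) s
      reach : AllReach root spanningTree
      reach j with j ∈? members
      ... | no  j∉S = reaches-step (spanningTree-outside j∉S)
      ... | yes j∈S with toRoot-reaches j∈S
      ...   | t , hit = t , trans (sym (iterate-cong-along toRoot spanningTree j (toℕ t)
                                          (λ s _ → sym (spanningTree-inside (orbit-within j∈S s))))) hit

    arborescenceWeight-root-pos : 0ℚ < arborescenceWeight root
    arborescenceWeight-root-pos =
      ℚₚ.<-≤-trans (prod-pos _ factor-pos) (treeWeight≤arborescenceWeight Q-nonNeg root tree tree-arborescence)
      where
      tree : Vec (Fin n) n
      tree = tabulate spanningTree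
      tree-arborescence : IsArborescence root (lookup tree)
      tree-arborescence = trans (Vecₚ.lookup∘tabulate spanningTree root) (proj₁ spanningTree-arborescence) ,
                          λ j → reaches-cong (λ x → sym (Vecₚ.lookup∘tabulate spanningTree x)) (proj₂ spanningTree-arborescence j)
      factor-pos : ∀ j → 0ℚ < rootedAt root j (lookup tree j)
      factor-pos j with j Finₚ.≟ root
      ... | yes refl = subst (0ℚ <_) (sym (𝟙-yes (lookup tree root Finₚ.≟ root) (proj₁ tree-arborescence))) 0<1
      ... | no  j≢r  = subst (λ l → 0ℚ < Q j l) (sym (Vecₚ.lookup∘tabulate spanningTree j)) (Q-spanning-pos j≢r)
        where
        Q-spanning-pos : j ≢ root → 0ℚ < Q j (spanningTree j)
        Q-spanning-pos j≢r with j ∈? members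
        ... | yes j∈S = toRoot-edge j∈S j≢r
        ... | no  _   = subst (0ℚ <_) (sym (𝟙-yes (root Finₚ.≟ root) refl)) 0<1

    arborescenceWeight-total-pos : 0ℚ < sum arborescenceWeight
    arborescenceWeight-total-pos =
      ℚₚ.<-≤-trans arborescenceWeight-root-pos (term≤sum _ (arborescenceWeight-nonNeg Q-nonNeg) root)

    arborescenceWeight-≤1 : ∀ i → arborescenceWeight i ≤ 1ℚ
    arborescenceWeight-≤1 = arborescenceWeight≤1 Q-nonNeg Q-rowSum

    prodRowDen*weight-isInteger : ∀ i → IsInteger (fromℕ (prodRowDen P) * arborescenceWeight i)
    prodRowDen*weight-isInteger i = arborescenceWeight-isInteger (rowDen P) i (λ j l _ →
      Q-scaledRow-isInteger (rowDen P j) j (λ l → isInteger-fromℕ-* (rowDen P j) (P j l) (↧ₙ∣rowDen P j l)) l)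

    allDen^[n-1]*weight-isInteger : ∀ i → IsInteger (fromℕ (allDen P ^ (n ∸ 1)) * arborescenceWeight i)
    allDen^[n-1]*weight-isInteger i =
      subst (λ m → IsInteger (fromℕ m * arborescenceWeight i)) (prodFin-except i (allDen P))
        (arborescenceWeight-isInteger (except i (allDen P)) i (λ j l j≢i →
          subst (λ m → IsInteger (fromℕ m * Q j l)) (sym (except-other (allDen P) j≢i))
            (Q-scaledRow-isInteger (allDen P) j (λ l → isInteger-fromℕ-* (allDen P) (P j l) (↧ₙ∣allDen P j l)) l)))

corollary1p2 : (n : ℕ) → 1 ℕ.≤ n → (P : Matrix n) → IsStochastic P → (r : Fin n → ℤ) →
    (∀ i j → ConvergesTo (λ N → avgReward P r N i - avgReward P r N j) 0ℚ) →
    Σ[ η ∈ ℚ ] ((∀ i → ConvergesTo (λ N → avgReward P r N i) η) ×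
                (↧ₙ η ℕ.≤ (n ℕ.* prodRowDen P) ⊓ (n ℕ.* allDen P ^ (n ∸ 1))))
corollary1p2 (suc m) _ P (P≥0 , rowΣ≡1) r a→same =
  gain , avgReward→gain a→same ,
  ℕₚ.⊓-glb (gain-denominator (prodRowDen P) prodRowDen*weight-isInteger arborescenceWeight-≤1)
           (gain-denominator (allDen P ^ m) allDen^[n-1]*weight-isInteger arborescenceWeight-≤1)
  where
  rowSum : ∀ i → sum (P i) ≡ 1ℚ
  rowSum i = trans (sym (Σ≡sum (P i))) (rowΣ≡1 i)
  open Collapse P P≥0 rowSum (accessibleClosedSet P ⊤ (∈⊤ {x = zero}) (λ _ _ → ∈⊤))
  open Gain P r arborescenceWeight arborescenceWeight-P-invariant arborescenceWeight-total-pos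
  instance
    D≢0 : ℕ.NonZero (prodRowDen P)
    D≢0 = prodFin-nonZero (rowDen P) (rowDen-nonZero P)
    M≢0 : ℕ.NonZero (allDen P)
    M≢0 = lcmFin-nonZero (rowDen P) (rowDen-nonZero P)
    M^m≢0 : ℕ.NonZero (allDen P ^ m)
    M^m≢0 = ℕₚ.m^n≢0 (allDen P) m
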